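{- Let $D\ge2$, $N\in\{2D,2D+1\}$, and let $\Gamma$, $\Lambda$, $E_k^{(r)}$, $E_k^{*(r)}$, $p^h_{ij}$ and $q^h_{ij}$ be as in the context. Then for all $h,i,j\in\{0,1,\dots,D\}$: - $E_h^{*(1)}E_i^{*(2)}E_j^{*(3)}\Lambda=\mathbf 0$ if and only if $p^h_{ij}=0$; - $E_h^{(1)}E_i^{(2)}E_j^{(3)}\Lambda=\mathbf 0$ if and only if $q^h_{ij}=0$.
   Context: $\Gamma$ is the cycle graph on $X=\{0,\dots,N-1\}=\mathbb{Z}/N\mathbb{Z}$, with $x\sim y$ iff $x-y\equiv\pm1 \pmod N$. Its distance is $\partial(x,y)=\min\{r,N-r\}$ with $r\equiv x-y \pmod N$, $0\le r<N$, and its diameter is $D$. Fix a primitive $N$-th root of unity $\zeta$ and set $\theta_i=\theta_i^*=\zeta^i+\zeta^{ -i}$ for $0\le i\le D$. $V$ has orthonormal basis $X$ and $A_1x=(x-1)+(x+1)$. $E_k$ is the orthogonal projection onto the $\theta_k$-eigenspace of $A_1$, for $0\le k\le D$. Operators on $V^{\otimes3}$: - $A^{(1)}=A_1\otimes I\otimes I$, $A^{(2)}=I\otimes A_1\otimes I$, $A^{(3)}=I\otimes I\otimes A_1$; - $E_k^{(1)}=E_k\otimes I\otimes I$, $E_k^{(2)}=I\otimes E_k\otimes I$, $E_k^{(3)}=I\otimes I\otimes E_k$; - $A^{*(1)},A^{*(2)},A^{*(3)}$ are diagonal, multiplying $x\otimes y\otimes z$ by $\theta^*_{\partial(y,z)}$,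 $\theta^*_{\partial(x,z)}$ and $\theta^*_{\partial(x,y)}$ respectively; - $E_k^{*(1)}$, $E_k^{*(2)}$, $E_k^{*(3)}$ map $x\otimes y\otimes z$ to itself if $\partial(y,z)=k$ (respectively $\partial(x,z)=k$, $\partial(x,y)=k$), and to $0$ otherwise. $\Lambda$ (the fundamental module) is the smallest subspace of $V^{\otimes3}$ that contains $\mathbf 1^{\otimes3}=\sum_{x,y,z}x\otimes y\otimes z$ and is invariant under $A^{(r)}$ and $A^{*(r)}$ ($r=1,2,3$). It is the unique irreducible submodule containing $\mathbf 1^{\otimes3}$ for the associated $S_3$-symmetric tridiagonal algebra. $p^h_{ij}$ is the number of $z\in X$ with $\partial(x,z)=i$ and $\partial(z,y)=j$, for any $x,y$ with $\partial(x,y)=h$ (this is independent of the choice). The scalars $q^h_{ij}$ are defined by $E_i\circ E_j=N^{ -1}\sum_{h=0}^Dq^h_{ij}E_h$, where $\circ$ is the entrywise product of matrices with respect to the basis $X$. -}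

module Defs where

open import Level using (Level)
open import Algebra.Bundles using (CommutativeRing)
open import Data.Nat using (ℕ; zero; suc; _∸_; _⊓_; NonZero; _≟_) renaming (_+_ to _+ℕ_; _*_ to _*ℕ_)
open import Data.Nat.DivMod using (_%_; m%n<n)
open import Data.Fin using (Fin; toℕ; fromℕ<)
open import Data.Fin.Base using () renaming (zero to fzero; suc to fsuc)
open import Data.Bool using (Bool; true; false; if_then_else_; _∨_)
open import Data.List using (length; filter; allFin)

open import Data.Fin.Base using ()
open import Data.List using (List)
open import Data.Product using (_×_)
open import Relation.Nullary.Decidable using (⌊_⌋; _×-dec_)
open import Relation.Binary.PropositionalEquality using (_≡_)

-- All vectors, operators and scalars live over a commutative ring R
-- (in the statement: a field of characteristic 0 containing a primitive
-- N-th root of unity ζ; Ninv is the inverse of N·1 in R).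
module Cycle {c ℓ : Level} (R : CommutativeRing c ℓ)
             (N : ℕ) {{_ : NonZero N}} (ζ Ninv : CommutativeRing.Carrier R) where

  open CommutativeRing R

  pow : Carrier → ℕ → Carrier
  pow x zero    = 1#
  pow x (suc n) = x * pow x n

  fromℕ : ℕ → Carrier
  fromℕ zero    = 0#
  fromℕ (suc n) = 1# + fromℕ n

  sumF : ∀ {n} → (Fin n → Carrier) → Carrier
  sumF {zero}  f = 0#
  sumF {suc n} f = f fzero + sumF (λ i → f (fsuc i))

  -- vertex set X = ℤ/Nℤ, represented by Fin N
  X : Set
  X = Fin N

  modN : ℕ → X
  modN m = fromℕ< (m%n<n m N)

  diff : X → X → ℕ
  diff x y = (toℕ x +ℕ (N ∸ toℕ y)) % N

  dist : X → X → ℕ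
  dist x y = diff x y ⊓ (N ∸ diff x y)

  next prev : X → X
  next x = modN (suc (toℕ x))
  prev x = modN (toℕ x +ℕ (N ∸ 1))

  -- θ_i = θ*_i = ζ^i + ζ^{-i}  (ζ^{-i} = ζ^{N-i} since ζ^N = 1)
  θ : ℕ → Carrier
  θ i = pow ζ i + pow ζ (N ∸ i)

  -- the primitive idempotent E_k as a matrix w.r.t. the basis X:
  -- orthogonal projection onto the span of the characters x ↦ ζ^{m x}, m ≡ ±k (mod N),
  -- E_k(x,y) = N⁻¹ Σ_{m<N, m ≡ ±k} ζ^{m (x - y)}
  Emat : ℕ → X → X → Carrier
  Emat k x y = Ninv * sumF (λ (m : Fin N) →
     if (⌊ toℕ m ≟ k ⌋ ∨ ⌊ toℕ m +ℕ k ≟ N ⌋)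
     then pow ζ (toℕ m *ℕ diff x y) else 0#)

  -- V^{⊗3}: coordinate functions on the basis x ⊗ y ⊗ z
  V3 : Set c
  V3 = X → X → X → Carrier

  Op : Set c
  Op = V3 → V3

  A¹ A² A³ : Op
  A¹ v x y z = v (prev x) y z + v (next x) y z
  A² v x y z = v x (prev y) z + v x (next y) z
  A³ v x y z = v x y (prev z) + v x y (next z)

  A*¹ A*² A*³ : Op
  A*¹ v x y z = θ (dist y z) * v x y z
  A*² v x y z = θ (dist x z) * v x y z
  A*³ v x y z = θ (dist x y) * v x y z

  E¹ E² E³ : ℕ → Op
  E¹ k v x y z = sumF (λ x' → Emat k x x' * v x' y z)
  E² k v x y z = sumF (λ y' → Emat k y y' * v x y' z)
  E³ k v x y z = sumF (λ z' → Emat k z z' * v x y z')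

  E*¹ E*² E*³ : ℕ → Op
  E*¹ k v x y z = if ⌊ dist y z ≟ k ⌋ then v x y z else 0#
  E*² k v x y z = if ⌊ dist x z ≟ k ⌋ then v x y z else 0#
  E*³ k v x y z = if ⌊ dist x y ≟ k ⌋ then v x y z else 0#

  one³ : V3
  one³ x y z = 1#

  -- Λ: the smallest subspace containing 1^{⊗3} and invariant under
  -- A^{(r)} and A^{*(r)}, as an inductively generated predicate
  data InΛ : V3 → Set (c Level.⊔ ℓ) where
    gen   : InΛ one³
    zero∈ : InΛ (λ x y z → 0#)
    add∈  : ∀ {u v} → InΛ u → InΛ v → InΛ (λ x y z → u x y z + v x y z)
    scal∈ : ∀ a {v} → InΛ v → InΛ (λ x y z → a * v x y z)
    resp∈ : ∀ {u v} → (∀ x y z → u x y z ≈ v x y z) → InΛ u → InΛ v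
    A¹∈   : ∀ {v} → InΛ v → InΛ (A¹ v)
    A²∈   : ∀ {v} → InΛ v → InΛ (A² v)
    A³∈   : ∀ {v} → InΛ v → InΛ (A³ v)
    A*¹∈  : ∀ {v} → InΛ v → InΛ (A*¹ v)
    A*²∈  : ∀ {v} → InΛ v → InΛ (A*² v)
    A*³∈  : ∀ {v} → InΛ v → InΛ (A*³ v)

  KillsΛ : Op → Set (c Level.⊔ ℓ)
  KillsΛ T = ∀ v → InΛ v → ∀ x y z → T v x y z ≈ 0#

  count : X → X → ℕ → ℕ → ℕ
  count x y i j = length (filter (λ z → (dist x z ≟ i) ×-dec (dist z y ≟ j)) (allFin N))

{-# OPTIONS --safe #-}
module Submission where

-- The p-part only reads the definitions: E*¹_h E*²_i E*³_j scales the coordinate at x ⊗ y ⊗ z by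
-- [∂(y,z) = h][∂(x,z) = i][∂(x,y) = j], and 𝟏⊗𝟏⊗𝟏 ∈ Λ has every coordinate equal to 1.
--
-- For the q-part, A₁ is diagonalised by the characters w ↦ ζ^{mw}, and E_k is the sum of the projections
-- onto the frequencies m ∈ M_k = {k, −k}. Put τ = Σ_w E_h(0,w) E_i(0,w) E_j(0,w). Expanding in characters,
-- τ = N⁻² · #{(a,b,c) ∈ M_h × M_i × M_j : a + b + c ≡ 0}; by the Krein condition, and because
-- Σ_w E_h(0,w) E_{h′}(0,w) vanishes exactly for h′ ≠ h, τ is q^h_{ij} times a nonzero scalar.
-- If q^h_{ij} = 0 there is thus no zero-sum triple (characteristic 0). Every vector of Λ is invariant
-- under the diagonal rotation (x,y,z) ↦ (x+1,y+1,z+1), so its (a,b,c) Fourier coefficient vanishes unless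
-- a + b + c ≡ 0, and E_h ⊗ E_i ⊗ E_j kills it. Conversely Λ contains Φ = ∏_{k=1}^{D} (A*³ − θ_k)(A*² − θ_k) 𝟏⊗𝟏⊗𝟏,
-- which lives on the diagonal x = y = z, and the (0,0,0) coordinate of E_h ⊗ E_i ⊗ E_j Φ is a nonzero
-- multiple of τ; so E_h ⊗ E_i ⊗ E_j Λ = 0 forces q^h_{ij} = 0.

open import Defs
open import Algebra.Bundles using (CommutativeRing)
open import Data.Nat using (ℕ; zero; suc; _∸_; _⊓_; _≤_; _<_; _≤?_; _<?_; s≤s; s≤s⁻¹; z<s; NonZero; >-nonZero⁻¹)
  renaming (_+_ to _+ℕ_; _*_ to _*ℕ_; _≟_ to _≟ℕ_)
import Data.Nat.Properties as ℕ
open import Data.Nat.DivMod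
  using (_%_; _/_; m%n<n; m≡m%n+[m/n]*n; %-distribˡ-+; m%n%n≡m%n; m<n⇒m%n≡m; n%n≡0; [m+n]%n≡m%n; m≤n⇒[n∸m]%m≡n%m)
open import Data.Fin using (Fin; toℕ; fromℕ<; inject₁; punchIn) renaming (fromℕ to fromℕᶠ; zero to fzero; suc to fsuc)
import Data.Fin.Properties as Fin
open import Data.Bool using (Bool; true; false; if_then_else_; _∨_)
open import Data.Product using (_×_; ∃; _,_; proj₂)
open import Data.Sum using (_⊎_; inj₁; inj₂; [_,_])
open import Data.Empty using (⊥-elim)
open import Function.Bundles using (_⇔_; mk⇔; Equivalence)
open import Relation.Nullary using (¬_; yes; no; Dec)
open import Relation.Nullary.Decidable using (⌊_⌋; _×-dec_)
import Relation.Nullary.Decidable as Dec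
open import Relation.Binary.PropositionalEquality as ≡ using (_≡_; _≢_)
open import Data.List using (_∷_; filter; allFin)
open import Data.List.Properties using (filter-some)
open import Data.List.Membership.Propositional using (_∈_; lose)
open import Data.List.Membership.Propositional.Properties using (∈-allFin; ∈-filter⁻)
open import Data.List.Relation.Unary.Any using (here)
open import Level using (Level)

module Properties {c ℓ : Level} (R : CommutativeRing c ℓ)
              (N : ℕ) {{_ : NonZero N}} (ζ Ninv : CommutativeRing.Carrier R) where

  open CommutativeRing R
  open Cycle R N ζ Ninv

  module _ where
    open ≡.≡-Reasoning

    [m%N+n]%N≡[m+n]%N : ∀ m n → (m % N +ℕ n) % N ≡ (m +ℕ n) % N
    [m%N+n]%N≡[m+n]%N m n = begin
      (m % N +ℕ n) % N            ≡⟨ %-distribˡ-+ (m % N) n N ⟩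
      (m % N % N +ℕ n % N) % N    ≡⟨ ≡.cong (λ k → (k +ℕ n % N) % N) (m%n%n≡m%n m N) ⟩
      (m % N +ℕ n % N) % N        ≡⟨ %-distribˡ-+ m n N ⟨
      (m +ℕ n) % N                ∎

    [m+n%N]%N≡[m+n]%N : ∀ m n → (m +ℕ n % N) % N ≡ (m +ℕ n) % N
    [m+n%N]%N≡[m+n]%N m n = begin
      (m +ℕ n % N) % N  ≡⟨ ≡.cong (_% N) (ℕ.+-comm m (n % N)) ⟩
      (n % N +ℕ m) % N  ≡⟨ [m%N+n]%N≡[m+n]%N n m ⟩
      (n +ℕ m) % N      ≡⟨ ≡.cong (_% N) (ℕ.+-comm n m) ⟩
      (m +ℕ n) % N      ∎

    toℕ-next : ∀ x → toℕ (next x) ≡ suc (toℕ x) % N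
    toℕ-next x = Fin.toℕ-fromℕ< _

    toℕ-prev : ∀ x → toℕ (prev x) ≡ (toℕ x +ℕ (N ∸ 1)) % N
    toℕ-prev x = Fin.toℕ-fromℕ< _

    toℕ%N≡toℕ : ∀ (x : X) → toℕ x % N ≡ toℕ x
    toℕ%N≡toℕ x = m<n⇒m%n≡m (Fin.toℕ<n x)

    [diff+y]%N≡x : ∀ x y → (diff x y +ℕ toℕ y) % N ≡ toℕ x
    [diff+y]%N≡x x y = begin
      (diff x y +ℕ toℕ y) % N                 ≡⟨ [m%N+n]%N≡[m+n]%N (toℕ x +ℕ (N ∸ toℕ y)) (toℕ y) ⟩
      (toℕ x +ℕ (N ∸ toℕ y) +ℕ toℕ y) % N     ≡⟨ ≡.cong (_% N) (ℕ.+-assoc (toℕ x) (N ∸ toℕ y) (toℕ y)) ⟩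
      (toℕ x +ℕ ((N ∸ toℕ y) +ℕ toℕ y)) % N   ≡⟨ ≡.cong (λ k → (toℕ x +ℕ k) % N) (ℕ.m∸n+n≡m (ℕ.<⇒≤ (Fin.toℕ<n y))) ⟩
      (toℕ x +ℕ N) % N                        ≡⟨ [m+n]%n≡m%n (toℕ x) N ⟩
      toℕ x % N                               ≡⟨ toℕ%N≡toℕ x ⟩
      toℕ x                                   ∎

    diff-unique : ∀ x y r → r < N → (r +ℕ toℕ y) % N ≡ toℕ x → diff x y ≡ r
    diff-unique x y r r<N [r+y]%N≡x = begin
      (toℕ x +ℕ (N ∸ toℕ y)) % N                ≡⟨ ≡.cong (λ k → (k +ℕ (N ∸ toℕ y)) % N) [r+y]%N≡x ⟨
      ((r +ℕ toℕ y) % N +ℕ (N ∸ toℕ y)) % N     ≡⟨ [m%N+n]%N≡[m+n]%N (r +ℕ toℕ y) (N ∸ toℕ y) ⟩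
      (r +ℕ toℕ y +ℕ (N ∸ toℕ y)) % N           ≡⟨ ≡.cong (_% N) (ℕ.+-assoc r (toℕ y) (N ∸ toℕ y)) ⟩
      (r +ℕ (toℕ y +ℕ (N ∸ toℕ y))) % N         ≡⟨ ≡.cong (λ k → (r +ℕ k) % N) (ℕ.m+[n∸m]≡n (ℕ.<⇒≤ (Fin.toℕ<n y))) ⟩
      (r +ℕ N) % N                              ≡⟨ [m+n]%n≡m%n r N ⟩
      r % N                                     ≡⟨ m<n⇒m%n≡m r<N ⟩
      r                                         ∎

    diff<N : ∀ x y → diff x y < N
    diff<N x y = m%n<n _ N

    diff-next-next : ∀ x y → diff (next x) (next y) ≡ diff x y
    diff-next-next x y = diff-unique (next x) (next y) (diff x y) (diff<N x y) (begin
      (diff x y +ℕ toℕ (next y)) % N        ≡⟨ ≡.cong (λ k → (diff x y +ℕ k) % N) (toℕ-next y) ⟩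
      (diff x y +ℕ suc (toℕ y) % N) % N     ≡⟨ [m+n%N]%N≡[m+n]%N (diff x y) (suc (toℕ y)) ⟩
      (diff x y +ℕ suc (toℕ y)) % N         ≡⟨ ≡.cong (_% N) (ℕ.+-suc (diff x y) (toℕ y)) ⟩
      suc (diff x y +ℕ toℕ y) % N           ≡⟨ [m+n%N]%N≡[m+n]%N 1 (diff x y +ℕ toℕ y) ⟨
      suc ((diff x y +ℕ toℕ y) % N) % N     ≡⟨ ≡.cong (λ k → suc k % N) ([diff+y]%N≡x x y) ⟩
      suc (toℕ x) % N                       ≡⟨ toℕ-next x ⟨
      toℕ (next x)                          ∎)

    suc-diff-next : ∀ x y → suc (diff x (next y)) % N ≡ diff x y
    suc-diff-next x y = ≡.sym (diff-unique x y (suc d′ % N) (m%n<n _ N) (begin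
      (suc d′ % N +ℕ toℕ y) % N        ≡⟨ [m%N+n]%N≡[m+n]%N (suc d′) (toℕ y) ⟩
      (suc d′ +ℕ toℕ y) % N            ≡⟨ ≡.cong (_% N) (ℕ.+-suc d′ (toℕ y)) ⟨
      (d′ +ℕ suc (toℕ y)) % N          ≡⟨ [m+n%N]%N≡[m+n]%N d′ (suc (toℕ y)) ⟨
      (d′ +ℕ suc (toℕ y) % N) % N      ≡⟨ ≡.cong (λ k → (d′ +ℕ k) % N) (toℕ-next y) ⟨
      (d′ +ℕ toℕ (next y)) % N         ≡⟨ [diff+y]%N≡x x (next y) ⟩
      toℕ x                            ∎))
      where
      d′ : ℕ
      d′ = diff x (next y)

    prev-next : ∀ x → prev (next x) ≡ next (prev x)
    prev-next x = Fin.toℕ-injective (begin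
      toℕ (prev (next x))                    ≡⟨ toℕ-prev (next x) ⟩
      (toℕ (next x) +ℕ (N ∸ 1)) % N          ≡⟨ ≡.cong (λ k → (k +ℕ (N ∸ 1)) % N) (toℕ-next x) ⟩
      (suc (toℕ x) % N +ℕ (N ∸ 1)) % N       ≡⟨ [m%N+n]%N≡[m+n]%N (suc (toℕ x)) (N ∸ 1) ⟩
      suc (toℕ x +ℕ (N ∸ 1)) % N             ≡⟨ [m+n%N]%N≡[m+n]%N 1 (toℕ x +ℕ (N ∸ 1)) ⟨
      suc ((toℕ x +ℕ (N ∸ 1)) % N) % N       ≡⟨ ≡.cong (λ k → suc k % N) (toℕ-prev x) ⟨
      suc (toℕ (prev x)) % N                 ≡⟨ toℕ-next (prev x) ⟨
      toℕ (next (prev x))                    ∎)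

    diff-sym : ∀ x y → diff y x ≡ (N ∸ diff x y) % N
    diff-sym x y = diff-unique y x ((N ∸ d) % N) (m%n<n _ N) (begin
      ((N ∸ d) % N +ℕ toℕ x) % N                 ≡⟨ [m%N+n]%N≡[m+n]%N (N ∸ d) (toℕ x) ⟩
      (N ∸ d +ℕ toℕ x) % N                       ≡⟨ ≡.cong (λ k → (N ∸ d +ℕ k) % N) ([diff+y]%N≡x x y) ⟨
      (N ∸ d +ℕ (d +ℕ toℕ y) % N) % N            ≡⟨ [m+n%N]%N≡[m+n]%N (N ∸ d) (d +ℕ toℕ y) ⟩
      (N ∸ d +ℕ (d +ℕ toℕ y)) % N                ≡⟨ ≡.cong (_% N) (ℕ.+-assoc (N ∸ d) d (toℕ y)) ⟨
      (N ∸ d +ℕ d +ℕ toℕ y) % N                  ≡⟨ ≡.cong (λ k → (k +ℕ toℕ y) % N) (ℕ.m∸n+n≡m (ℕ.<⇒≤ (diff<N x y))) ⟩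
      (N +ℕ toℕ y) % N                           ≡⟨ ≡.cong (_% N) (ℕ.+-comm N (toℕ y)) ⟩
      (toℕ y +ℕ N) % N                           ≡⟨ [m+n]%n≡m%n (toℕ y) N ⟩
      toℕ y % N                                  ≡⟨ toℕ%N≡toℕ y ⟩
      toℕ y                                      ∎)
      where
      d : ℕ
      d = diff x y

    x₀ : X
    x₀ = fromℕ< (>-nonZero⁻¹ N)

    toℕ-x₀ : toℕ x₀ ≡ 0
    toℕ-x₀ = Fin.toℕ-fromℕ< _

    neg : X → X
    neg x = modN (N ∸ toℕ x)

    [x+neg-x]%N≡0 : ∀ x → (toℕ x +ℕ toℕ (neg x)) % N ≡ 0
    [x+neg-x]%N≡0 x = begin
      (toℕ x +ℕ toℕ (neg x)) % N      ≡⟨ ≡.cong (λ k → (toℕ x +ℕ k) % N) (Fin.toℕ-fromℕ< _) ⟩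
      (toℕ x +ℕ (N ∸ toℕ x) % N) % N  ≡⟨ [m+n%N]%N≡[m+n]%N (toℕ x) (N ∸ toℕ x) ⟩
      (toℕ x +ℕ (N ∸ toℕ x)) % N      ≡⟨ ≡.cong (_% N) (ℕ.m+[n∸m]≡n (ℕ.<⇒≤ (Fin.toℕ<n x))) ⟩
      N % N                           ≡⟨ n%n≡0 N ⟩
      0                               ∎

  dist-next-next : ∀ x y → dist (next x) (next y) ≡ dist x y
  dist-next-next x y = ≡.cong (λ d → d ⊓ (N ∸ d)) (diff-next-next x y)

  dist-sym : ∀ x y → dist y x ≡ dist x y
  dist-sym x y = ≡.trans (≡.cong (λ d → d ⊓ (N ∸ d)) (diff-sym x y)) (min-complement (diff x y) (diff<N x y))
    where
    min-complement : ∀ d → d < N → ((N ∸ d) % N) ⊓ (N ∸ (N ∸ d) % N) ≡ d ⊓ (N ∸ d)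
    min-complement zero    _   = ≡.cong (λ k → k ⊓ (N ∸ k)) (n%n≡0 N)
    min-complement (suc k) d<N = ≡.trans (≡.cong (λ j → j ⊓ (N ∸ j)) (m<n⇒m%n≡m N∸d<N))
      (≡.trans (≡.cong ((N ∸ suc k) ⊓_) (ℕ.m∸[m∸n]≡n (ℕ.<⇒≤ d<N))) (ℕ.⊓-comm (N ∸ suc k) (suc k)))
      where
      N∸d<N : N ∸ suc k < N
      N∸d<N = ℕ.∸-monoʳ-< z<s (ℕ.<⇒≤ d<N)

  dist≡0⇒≡ : ∀ x y → dist x y ≡ 0 → x ≡ y
  dist≡0⇒≡ x y dist≡0 = Fin.toℕ-injective (≡.trans (≡.sym ([diff+y]%N≡x x y))
    (≡.trans (≡.cong (λ k → (k +ℕ toℕ y) % N) (diff≡0 (diff x y) (diff<N x y) dist≡0)) (toℕ%N≡toℕ y)))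
    where
    diff≡0 : ∀ d → d < N → d ⊓ (N ∸ d) ≡ 0 → d ≡ 0
    diff≡0 zero    _   _  = ≡.refl
    diff≡0 (suc k) d<N eq with N ∸ suc k in N∸d
    ... | zero  = ⊥-elim (ℕ.<⇒≱ d<N (ℕ.m∸n≡0⇒m≤n N∸d))
    ... | suc _ with () ← eq

  dist-refl : ∀ x → dist x x ≡ 0
  dist-refl x = ≡.cong (λ k → k ⊓ (N ∸ k)) (diff-unique x x 0 (>-nonZero⁻¹ N) (toℕ%N≡toℕ x))

  open import Relation.Binary.Reasoning.Setoid setoid
  open import Algebra.Properties.Semiring.Sum semiring
    using (sum; sum-cong-≋; sum-replicate; sum-replicate-zero; sum-remove; sum-init-last;
           sum-cong-≗; ∑-comm; *-distribˡ-sum; *-distribʳ-sum)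
  open import Algebra.Properties.Semiring.Mult semiring using (×-homo-+) renaming (_×_ to _×ₙ_)
  open import Algebra.Properties.CommutativeSemiring.Exp commutativeSemiring
    using (_^_; ^-congˡ; ^-homo-*; ^-assocʳ)
  open import Algebra.Properties.CommutativeSemigroup *-commutativeSemigroup using (x∙yz≈y∙xz)
  open import Algebra.Properties.Ring ring
    using (x∙y⁻¹≈ε⇒x≈y; [y-z]x≈yx-zx; -‿+-comm; -‿distribˡ-*; -‿distribʳ-*; -‿involutive)
  open import Algebra.Solver.Ring.NaturalCoefficients.Default commutativeSemiring using (solve; _:=_; _:+_; _:*_)

  sumF≡sum : ∀ {n} (f : Fin n → Carrier) → sumF f ≡ sum f
  sumF≡sum {zero}  f = ≡.refl
  sumF≡sum {suc n} f = ≡.cong (f fzero +_) (sumF≡sum (λ i → f (fsuc i)))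

  pow≡^ : ∀ x n → pow x n ≡ x ^ n
  pow≡^ x zero    = ≡.refl
  pow≡^ x (suc n) = ≡.cong (x *_) (pow≡^ x n)

  fromℕ≡×ₙ1 : ∀ n → fromℕ n ≡ n ×ₙ 1#
  fromℕ≡×ₙ1 zero    = ≡.refl
  fromℕ≡×ₙ1 (suc n) = ≡.cong (1# +_) (fromℕ≡×ₙ1 n)

  fromℕ-+ : ∀ m n → fromℕ (m +ℕ n) ≈ fromℕ m + fromℕ n
  fromℕ-+ m n = begin
    fromℕ (m +ℕ n)            ≡⟨ fromℕ≡×ₙ1 (m +ℕ n) ⟩
    (m +ℕ n) ×ₙ 1#            ≈⟨ ×-homo-+ 1# m n ⟩
    m ×ₙ 1# + n ×ₙ 1#         ≡⟨ ≡.cong₂ _+_ (fromℕ≡×ₙ1 m) (fromℕ≡×ₙ1 n) ⟨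
    fromℕ m + fromℕ n         ∎

  sumF-cong : ∀ {n} {f g : Fin n → Carrier} → (∀ i → f i ≈ g i) → sumF f ≈ sumF g
  sumF-cong {f = f} {g} f≈g = begin
    sumF f ≡⟨ sumF≡sum f ⟩
    sum f  ≈⟨ sum-cong-≋ f≈g ⟩
    sum g  ≡⟨ sumF≡sum g ⟨
    sumF g ∎

  sumF-zero : ∀ {n} {f : Fin n → Carrier} → (∀ i → f i ≈ 0#) → sumF f ≈ 0#
  sumF-zero {n} f≈0 = trans (sumF-cong f≈0) (trans (reflexive (sumF≡sum {n} (λ _ → 0#))) (sum-replicate-zero n))

  *-distribˡ-sumF : ∀ {n} k (f : Fin n → Carrier) → k * sumF f ≈ sumF (λ i → k * f i)
  *-distribˡ-sumF k f = begin
    k * sumF f            ≡⟨ ≡.cong (k *_) (sumF≡sum f) ⟩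
    k * sum f             ≈⟨ *-distribˡ-sum k f ⟩
    sum (λ i → k * f i)   ≡⟨ sumF≡sum (λ i → k * f i) ⟨
    sumF (λ i → k * f i)  ∎

  *-distribʳ-sumF : ∀ {n} k (f : Fin n → Carrier) → sumF f * k ≈ sumF (λ i → f i * k)
  *-distribʳ-sumF k f = begin
    sumF f * k            ≡⟨ ≡.cong (_* k) (sumF≡sum f) ⟩
    sum f * k             ≈⟨ *-distribʳ-sum k f ⟩
    sum (λ i → f i * k)   ≡⟨ sumF≡sum (λ i → f i * k) ⟨
    sumF (λ i → f i * k)  ∎

  sumF-comm : ∀ {m n} (f : Fin m → Fin n → Carrier) →
              sumF (λ i → sumF (λ j → f i j)) ≈ sumF (λ j → sumF (λ i → f i j))
  sumF-comm f = begin
    sumF (λ i → sumF (λ j → f i j)) ≈⟨ sumF-cong (λ i → reflexive (sumF≡sum (f i))) ⟩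
    sumF (λ i → sum (λ j → f i j))  ≡⟨ sumF≡sum (λ i → sum (f i)) ⟩
    sum (λ i → sum (λ j → f i j))   ≈⟨ ∑-comm f ⟩
    sum (λ j → sum (λ i → f i j))   ≡⟨ sumF≡sum (λ j → sum (λ i → f i j)) ⟨
    sumF (λ j → sum (λ i → f i j))  ≈⟨ sumF-cong (λ j → reflexive (sumF≡sum (λ i → f i j))) ⟨
    sumF (λ j → sumF (λ i → f i j)) ∎

  sumF-one : ∀ n → sumF {n} (λ _ → 1#) ≈ fromℕ n
  sumF-one n = begin
    sumF {n} (λ _ → 1#) ≡⟨ sumF≡sum {n} (λ _ → 1#) ⟩
    sum {n} (λ _ → 1#)  ≈⟨ sum-replicate n ⟩
    n ×ₙ 1#             ≡⟨ fromℕ≡×ₙ1 n ⟨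
    fromℕ n             ∎

  sumF-single : ∀ {n} (f : Fin n → Carrier) i₀ → (∀ i → i ≢ i₀ → f i ≈ 0#) → sumF f ≈ f i₀
  sumF-single {suc n} f i₀ f≈0 = begin
    sumF f                      ≡⟨ sumF≡sum f ⟩
    sum f                       ≈⟨ sum-remove f ⟩
    f i₀ + sum f∘punchIn       ≈⟨ +-congˡ rest≈0 ⟩
    f i₀ + 0#                   ≈⟨ +-identityʳ _ ⟩
    f i₀                        ∎
    where
    f∘punchIn : Fin n → Carrier
    f∘punchIn j = f (punchIn i₀ j)
    rest≈0 : sum f∘punchIn ≈ 0#
    rest≈0 = trans (sum-cong-≋ (λ j → f≈0 _ (Fin.punchInᵢ≢i i₀ j))) (sum-replicate-zero n)

  sumF-rotate : ∀ {M} .{{_ : NonZero M}} (g : Fin M → Fin M) → (∀ i → toℕ (g i) ≡ suc (toℕ i) % M) →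
                (f : Fin M → Carrier) → sumF (λ i → f (g i)) ≈ sumF f
  sumF-rotate {suc n} g g-suc f = begin
    sumF (λ i → f (g i))                              ≡⟨ sumF≡sum (λ i → f (g i)) ⟩
    sum (λ i → f (g i))                               ≈⟨ sum-init-last (λ i → f (g i)) ⟩
    sum (λ i → f (g (inject₁ i))) + f (g (fromℕᶠ n))  ≡⟨ ≡.cong₂ _+_ (sum-cong-≗ (λ i → ≡.cong f (g-inject₁ i))) (≡.cong f g-last) ⟩
    sum (λ i → f (fsuc i)) + f fzero                  ≈⟨ +-comm _ _ ⟩
    f fzero + sum (λ i → f (fsuc i))                  ≡⟨ sumF≡sum f ⟨
    sumF f                                            ∎
    where
    g-inject₁ : ∀ i → g (inject₁ i) ≡ fsuc i
    g-inject₁ i = Fin.toℕ-injective (≡.trans (g-suc (inject₁ i))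
      (≡.trans (≡.cong (λ k → suc k % suc n) (Fin.toℕ-inject₁ i)) (m<n⇒m%n≡m (s≤s (Fin.toℕ<n i)))))
    g-last : g (fromℕᶠ n) ≡ fzero
    g-last = Fin.toℕ-injective (≡.trans (g-suc (fromℕᶠ n))
      (≡.trans (≡.cong (λ k → suc k % suc n) (Fin.toℕ-fromℕ n)) (n%n≡0 (suc n))))

  sumF-next : (f : X → Carrier) → sumF (λ x → f (next x)) ≈ sumF f
  sumF-next = sumF-rotate next toℕ-next

  when : Bool → Carrier → Carrier
  when b x = if b then x else 0#

  when-cong : ∀ b {x y} → x ≈ y → when b x ≈ when b y
  when-cong true  x≈y = x≈y
  when-cong false _   = refl

  when-*ʳ : ∀ b x y → when b x * y ≈ when b (x * y)
  when-*ʳ true  x y = refl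
  when-*ʳ false x y = zeroˡ y

  *-when : ∀ b x y → y * when b x ≈ when b (y * x)
  *-when true  x y = refl
  *-when false x y = zeroʳ y

  sumF-when : ∀ {n} b (f : Fin n → Carrier) → sumF (λ i → when b (f i)) ≈ when b (sumF f)
  sumF-when true  f = refl
  sumF-when {n} false f = sumF-zero {n} (λ _ → refl)

  sumWhen : ∀ {n} → (Fin n → Bool) → (Fin n → Carrier) → Carrier
  sumWhen B f = sumF (λ i → when (B i) (f i))

  sumWhen-cong : ∀ {n} (B : Fin n → Bool) {f g : Fin n → Carrier} → (∀ i → f i ≈ g i) → sumWhen B f ≈ sumWhen B g
  sumWhen-cong B f≈g = sumF-cong (λ i → when-cong (B i) (f≈g i))

  sumWhen-zero : ∀ {n} (B : Fin n → Bool) {f : Fin n → Carrier} → (∀ i → B i ≡ true → f i ≈ 0#) → sumWhen B f ≈ 0#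
  sumWhen-zero B f≈0 = sumF-zero (λ i → when-zero (B i) (f≈0 i))
    where
    when-zero : ∀ b {x} → (b ≡ true → x ≈ 0#) → when b x ≈ 0#
    when-zero true  x≈0 = x≈0 ≡.refl
    when-zero false _   = refl

  *-distribˡ-sumWhen : ∀ {n} k (B : Fin n → Bool) f → k * sumWhen B f ≈ sumWhen B (λ i → k * f i)
  *-distribˡ-sumWhen k B f = trans (*-distribˡ-sumF k (λ i → when (B i) (f i))) (sumF-cong (λ i → *-when (B i) (f i) k))

  sumF-sumWhen-*ʳ : ∀ {m n} (B : Fin m → Bool) (f : Fin m → Fin n → Carrier) (g : Fin n → Carrier) →
    sumF (λ w → sumWhen B (λ i → f i w) * g w) ≈ sumWhen B (λ i → sumF (λ w → f i w * g w))
  sumF-sumWhen-*ʳ B f g = begin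
    sumF (λ w → sumWhen B (λ i → f i w) * g w)        ≈⟨ sumF-cong (λ w → *-distribʳ-sumF (g w) (λ i → when (B i) (f i w))) ⟩
    sumF (λ w → sumF (λ i → when (B i) (f i w) * g w)) ≈⟨ sumF-cong (λ w → sumF-cong (λ i → when-*ʳ (B i) (f i w) (g w))) ⟩
    sumF (λ w → sumF (λ i → when (B i) (f i w * g w))) ≈⟨ sumF-comm (λ w i → when (B i) (f i w * g w)) ⟩
    sumF (λ i → sumF (λ w → when (B i) (f i w * g w))) ≈⟨ sumF-cong (λ i → sumF-when (B i) (λ w → f i w * g w)) ⟩
    sumWhen B (λ i → sumF (λ w → f i w * g w))        ∎

  pow-+ : ∀ x m n → pow x (m +ℕ n) ≈ pow x m * pow x n
  pow-+ x m n = begin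
    pow x (m +ℕ n)     ≡⟨ pow≡^ x (m +ℕ n) ⟩
    x ^ (m +ℕ n)       ≈⟨ ^-homo-* x m n ⟩
    x ^ m * x ^ n      ≡⟨ ≡.cong₂ _*_ (pow≡^ x m) (pow≡^ x n) ⟨
    pow x m * pow x n  ∎

  pow-* : ∀ x m n → pow x (m *ℕ n) ≈ pow (pow x m) n
  pow-* x m n = begin
    pow x (m *ℕ n)   ≡⟨ pow≡^ x (m *ℕ n) ⟩
    x ^ (m *ℕ n)     ≈⟨ ^-assocʳ x m n ⟨
    (x ^ m) ^ n      ≡⟨ ≡.trans (≡.cong (λ y → pow y n) (pow≡^ x m)) (pow≡^ (x ^ m) n) ⟨
    pow (pow x m) n  ∎

  pow-cong : ∀ {x y} n → x ≈ y → pow x n ≈ pow y n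
  pow-cong {x} {y} n x≈y = begin
    pow x n  ≡⟨ pow≡^ x n ⟩
    x ^ n    ≈⟨ ^-congˡ n x≈y ⟩
    y ^ n    ≡⟨ pow≡^ y n ⟨
    pow y n  ∎

  pow-one : ∀ n → pow 1# n ≈ 1#
  pow-one zero    = refl
  pow-one (suc n) = trans (*-identityˡ _) (pow-one n)

  pow-% : ∀ u n → pow u N ≈ 1# → pow u (n % N) ≈ pow u n
  pow-% u n uᴺ≈1 = sym (begin
    pow u n                                  ≡⟨ ≡.cong (pow u) (m≡m%n+[m/n]*n n N) ⟩
    pow u (n % N +ℕ n / N *ℕ N)              ≈⟨ pow-+ u (n % N) _ ⟩
    pow u (n % N) * pow u (n / N *ℕ N)       ≡⟨ ≡.cong (λ k → pow u (n % N) * pow u k) (ℕ.*-comm (n / N) N) ⟩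
    pow u (n % N) * pow u (N *ℕ (n / N))     ≈⟨ *-congˡ (pow-* u N (n / N)) ⟩
    pow u (n % N) * pow (pow u N) (n / N)    ≈⟨ *-congˡ (trans (pow-cong (n / N) uᴺ≈1) (pow-one (n / N))) ⟩
    pow u (n % N) * 1#                       ≈⟨ *-identityʳ _ ⟩
    pow u (n % N)                            ∎)

  χ : ℕ → X → X → Carrier
  χ m x y = pow ζ (m *ℕ diff x y)

  χ-+ : ∀ m n x y → χ m x y * χ n x y ≈ χ (m +ℕ n) x y
  χ-+ m n x y = trans (sym (pow-+ ζ (m *ℕ diff x y) (n *ℕ diff x y)))
                      (reflexive (≡.cong (pow ζ) (≡.sym (ℕ.*-distribʳ-+ (diff x y) m n))))

  -- isFreq k is M_k = {k, −k mod N}; Emat k x y is by definition Ninv * sumWhen (isFreq k) (λ m → χ (toℕ m) x y).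
  isFreq : ℕ → X → Bool
  isFreq k m = ⌊ toℕ m ≟ℕ k ⌋ ∨ ⌊ toℕ m +ℕ k ≟ℕ N ⌋

  isFreq-elim : ∀ k m → isFreq k m ≡ true → toℕ m ≡ k ⊎ toℕ m +ℕ k ≡ N
  isFreq-elim k m isFreq≡true with toℕ m ≟ℕ k | toℕ m +ℕ k ≟ℕ N
  isFreq-elim k m _  | yes m≡k | _         = inj₁ m≡k
  isFreq-elim k m _  | no _    | yes m+k≡N = inj₂ m+k≡N
  isFreq-elim k m () | no _    | no _

  isFreq-intro : ∀ k m → toℕ m ≡ k ⊎ toℕ m +ℕ k ≡ N → isFreq k m ≡ true
  isFreq-intro k m m≡k⊎m+k≡N with toℕ m ≟ℕ k | toℕ m +ℕ k ≟ℕ N | m≡k⊎m+k≡N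
  ... | yes _  | _        | _          = ≡.refl
  ... | no _   | yes _    | _          = ≡.refl
  ... | no m≢k | no _     | inj₁ m≡k   = ⊥-elim (m≢k m≡k)
  ... | no _   | no m+k≢N | inj₂ m+k≡N = ⊥-elim (m+k≢N m+k≡N)

  +≡0⊎+≡N : ∀ (a b : X) → (toℕ a +ℕ toℕ b) % N ≡ 0 → toℕ a +ℕ toℕ b ≡ 0 ⊎ toℕ a +ℕ toℕ b ≡ N
  +≡0⊎+≡N a b [a+b]%N≡0 with toℕ a +ℕ toℕ b <? N
  ... | yes a+b<N = inj₁ (≡.trans (≡.sym (m<n⇒m%n≡m a+b<N)) [a+b]%N≡0)
  ... | no  a+b≮N = inj₂ (ℕ.≤-antisym (ℕ.m∸n≡0⇒m≤n a+b∸N≡0) (ℕ.≮⇒≥ a+b≮N))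
    where
    a+b∸N<N : toℕ a +ℕ toℕ b ∸ N < N
    a+b∸N<N = ℕ.m<n+o⇒m∸n<o (toℕ a +ℕ toℕ b) N (ℕ.+-mono-< (Fin.toℕ<n a) (Fin.toℕ<n b))
    a+b∸N≡0 : toℕ a +ℕ toℕ b ∸ N ≡ 0
    a+b∸N≡0 = ≡.trans (≡.sym (m<n⇒m%n≡m a+b∸N<N)) (≡.trans (m≤n⇒[n∸m]%m≡n%m (ℕ.≮⇒≥ a+b≮N)) [a+b]%N≡0)

  isFreq-neg-closed : ∀ k a b → isFreq k a ≡ true → (toℕ a +ℕ toℕ b) % N ≡ 0 → isFreq k b ≡ true
  isFreq-neg-closed k a b a∈Mₖ [a+b]%N≡0 = isFreq-intro k b (cases (isFreq-elim k a a∈Mₖ) (+≡0⊎+≡N a b [a+b]%N≡0))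
    where
    cases : toℕ a ≡ k ⊎ toℕ a +ℕ k ≡ N → toℕ a +ℕ toℕ b ≡ 0 ⊎ toℕ a +ℕ toℕ b ≡ N → toℕ b ≡ k ⊎ toℕ b +ℕ k ≡ N
    cases (inj₁ a≡k)   (inj₁ a+b≡0) = inj₁ (≡.trans (ℕ.m+n≡0⇒n≡0 (toℕ a) a+b≡0) (≡.trans (≡.sym (ℕ.m+n≡0⇒m≡0 (toℕ a) a+b≡0)) a≡k))
    cases (inj₁ a≡k)   (inj₂ a+b≡N) = inj₂ (≡.trans (ℕ.+-comm (toℕ b) k) (≡.trans (≡.cong (_+ℕ toℕ b) (≡.sym a≡k)) a+b≡N))
    cases (inj₂ a+k≡N) (inj₁ a+b≡0) = inj₂ (≡.trans (≡.cong₂ _+ℕ_ (ℕ.m+n≡0⇒n≡0 (toℕ a) a+b≡0) ≡.refl)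
                                         (≡.trans (≡.cong (_+ℕ k) (≡.sym (ℕ.m+n≡0⇒m≡0 (toℕ a) a+b≡0))) a+k≡N))
    cases (inj₂ a+k≡N) (inj₂ a+b≡N) = inj₁ (ℕ.+-cancelˡ-≡ (toℕ a) (toℕ b) k (≡.trans a+b≡N (≡.sym a+k≡N)))

  ℱ : ℕ → X → (X → Carrier) → Carrier
  ℱ m x f = sumF (λ x′ → χ m x x′ * f x′)

  ℱ-cong : ∀ m x {f g} → (∀ x′ → f x′ ≈ g x′) → ℱ m x f ≈ ℱ m x g
  ℱ-cong m x f≈g = sumF-cong (λ x′ → *-congˡ (f≈g x′))

  Emat-expand : ∀ k x (f : X → Carrier) →
    sumF (λ w → Emat k x w * f w) ≈ Ninv * sumWhen (isFreq k) (λ m → ℱ (toℕ m) x f)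
  Emat-expand k x f = begin
    sumF (λ w → Ninv * E w * f w)      ≈⟨ sumF-cong (λ w → *-assoc Ninv (E w) (f w)) ⟩
    sumF (λ w → Ninv * (E w * f w))    ≈⟨ *-distribˡ-sumF Ninv (λ w → E w * f w) ⟨
    Ninv * sumF (λ w → E w * f w)      ≈⟨ *-congˡ (sumF-sumWhen-*ʳ (isFreq k) (λ m w → χ (toℕ m) x w) f) ⟩
    Ninv * sumWhen (isFreq k) (λ m → ℱ (toℕ m) x f) ∎
    where
    E : X → Carrier
    E w = sumWhen (isFreq k) (λ m → χ (toℕ m) x w)

  ℱ-*ʳ : ∀ m x f t → ℱ m x f * t ≈ ℱ m x (λ x′ → f x′ * t)
  ℱ-*ʳ m x f t = trans (*-distribʳ-sumF t (λ x′ → χ m x x′ * f x′)) (sumF-cong {N} (λ x′ → *-assoc _ _ _))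

  ℱ-sumF : ∀ m x (g : X → Carrier) (G : X → X → Carrier) →
    ℱ m x (λ x′ → sumF (λ y′ → g y′ * G x′ y′)) ≈ sumF (λ y′ → g y′ * ℱ m x (λ x′ → G x′ y′))
  ℱ-sumF m x g G = begin
    sumF (λ x′ → χ m x x′ * sumF (λ y′ → g y′ * G x′ y′))
      ≈⟨ sumF-cong (λ x′ → *-distribˡ-sumF (χ m x x′) (λ y′ → g y′ * G x′ y′)) ⟩
    sumF (λ x′ → sumF (λ y′ → χ m x x′ * (g y′ * G x′ y′)))
      ≈⟨ sumF-comm (λ x′ y′ → χ m x x′ * (g y′ * G x′ y′)) ⟩
    sumF (λ y′ → sumF (λ x′ → χ m x x′ * (g y′ * G x′ y′)))
      ≈⟨ sumF-cong (λ y′ → sumF-cong (λ x′ → x∙yz≈y∙xz (χ m x x′) (g y′) (G x′ y′))) ⟩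
    sumF (λ y′ → sumF (λ x′ → g y′ * (χ m x x′ * G x′ y′)))
      ≈⟨ sumF-cong (λ y′ → *-distribˡ-sumF (g y′) (λ x′ → χ m x x′ * G x′ y′)) ⟨
    sumF (λ y′ → g y′ * ℱ m x (λ x′ → G x′ y′))              ∎

  ℱ-zero : ∀ x f → ℱ 0 x f ≈ sumF f
  ℱ-zero x f = sumF-cong {N} (λ w → *-identityˡ (f w))

  ℱ-χ : ∀ m n x g → ℱ n x (λ w → χ m x w * g w) ≈ ℱ (m +ℕ n) x g
  ℱ-χ m n x g = sumF-cong {N} (λ w → begin
    χ n x w * (χ m x w * g w)  ≈⟨ *-assoc _ _ _ ⟨
    χ n x w * χ m x w * g w    ≈⟨ *-congʳ (trans (*-comm _ _) (χ-+ m n x w)) ⟩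
    χ (m +ℕ n) x w * g w       ∎)

  ℱ-Emat : ∀ m k x g → ℱ m x (λ w → Emat k x w * g w) ≈ Ninv * sumWhen (isFreq k) (λ a → ℱ (m +ℕ toℕ a) x g)
  ℱ-Emat m k x g = begin
    ℱ m x (λ w → Emat k x w * g w)                                    ≈⟨ sumF-cong {N} (λ w → x∙yz≈y∙xz (χ m x w) (Emat k x w) (g w)) ⟩
    sumF (λ w → Emat k x w * (χ m x w * g w))                         ≈⟨ Emat-expand k x (λ w → χ m x w * g w) ⟩
    Ninv * sumWhen (isFreq k) (λ a → ℱ (toℕ a) x (λ w → χ m x w * g w)) ≈⟨ *-congˡ (sumWhen-cong (isFreq k) (λ a → ℱ-χ m (toℕ a) x g)) ⟩
    Ninv * sumWhen (isFreq k) (λ a → ℱ (m +ℕ toℕ a) x g)              ∎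

  Emat-annihilates : ∀ k x f → (∀ m → isFreq k m ≡ true → ℱ (toℕ m) x f ≈ 0#) → sumF (λ w → Emat k x w * f w) ≈ 0#
  Emat-annihilates k x f ℱf≈0 = trans (Emat-expand k x f) (trans (*-congˡ (sumWhen-zero (isFreq k) ℱf≈0)) (zeroʳ Ninv))

  charSum : ℕ → Carrier
  charSum n = ℱ n x₀ (λ _ → 1#)

  Epair : ℕ → ℕ → Carrier
  Epair h h′ = sumF (λ w → Emat h x₀ w * Emat h′ x₀ w)

  Etriple : ℕ → ℕ → ℕ → Carrier
  Etriple h i j = sumF (λ w → Emat h x₀ w * (Emat i x₀ w * Emat j x₀ w))

  -- N times the number of (a, b) ∈ M_h × M_h′, resp. (a, b, c) ∈ M_h × M_i × M_j, with vanishing sum mod N.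
  zeroSums₂ : ℕ → ℕ → Carrier
  zeroSums₂ h h′ = sumWhen (isFreq h) (λ a → sumWhen (isFreq h′) (λ b → charSum (toℕ a +ℕ toℕ b)))

  zeroSums₃ : ℕ → ℕ → ℕ → Carrier
  zeroSums₃ h i j =
    sumWhen (isFreq h) (λ a → sumWhen (isFreq i) (λ b → sumWhen (isFreq j) (λ c → charSum (toℕ a +ℕ toℕ b +ℕ toℕ c))))

  Epair-expand : ∀ h h′ → Epair h h′ ≈ Ninv * (Ninv * zeroSums₂ h h′)
  Epair-expand h h′ = begin
    sumF (λ w → Emat h x₀ w * Emat h′ x₀ w)
      ≈⟨ trans (ℱ-zero x₀ (λ w → Emat h x₀ w * (Emat h′ x₀ w * 1#))) (sumF-cong {N} (λ w → *-congˡ (*-identityʳ _))) ⟨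
    ℱ 0 x₀ (λ w → Emat h x₀ w * (Emat h′ x₀ w * 1#))
      ≈⟨ ℱ-Emat 0 h x₀ (λ w → Emat h′ x₀ w * 1#) ⟩
    Ninv * sumWhen (isFreq h) (λ a → ℱ (toℕ a) x₀ (λ w → Emat h′ x₀ w * 1#))
      ≈⟨ *-congˡ (sumWhen-cong (isFreq h) (λ a → ℱ-Emat (toℕ a) h′ x₀ (λ _ → 1#))) ⟩
    Ninv * sumWhen (isFreq h) (λ a → Ninv * sumWhen (isFreq h′) (λ b → charSum (toℕ a +ℕ toℕ b)))
      ≈⟨ *-congˡ (*-distribˡ-sumWhen Ninv (isFreq h) (λ a → sumWhen (isFreq h′) (λ b → charSum (toℕ a +ℕ toℕ b)))) ⟨
    Ninv * (Ninv * zeroSums₂ h h′)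
      ∎

  Etriple-expand : ∀ h i j → Etriple h i j ≈ Ninv * (Ninv * (Ninv * zeroSums₃ h i j))
  Etriple-expand h i j = begin
    sumF (λ w → Emat h x₀ w * (Emat i x₀ w * Emat j x₀ w))
      ≈⟨ trans (ℱ-zero x₀ (λ w → Emat h x₀ w * (Emat i x₀ w * (Emat j x₀ w * 1#))))
               (sumF-cong {N} (λ w → *-congˡ (*-congˡ (*-identityʳ _)))) ⟨
    ℱ 0 x₀ (λ w → Emat h x₀ w * (Emat i x₀ w * (Emat j x₀ w * 1#)))
      ≈⟨ ℱ-Emat 0 h x₀ _ ⟩
    Ninv * sumWhen (isFreq h) (λ a → ℱ (toℕ a) x₀ (λ w → Emat i x₀ w * (Emat j x₀ w * 1#)))
      ≈⟨ *-congˡ (sumWhen-cong (isFreq h) (λ a → trans (ℱ-Emat (toℕ a) i x₀ _) (*-congˡ (sumWhen-cong (isFreq i) (λ b →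
           ℱ-Emat (toℕ a +ℕ toℕ b) j x₀ (λ _ → 1#)))))) ⟩
    Ninv * sumWhen (isFreq h) (λ a → Ninv * sumWhen (isFreq i) (λ b → Ninv * F a b))
      ≈⟨ *-congˡ (sumWhen-cong (isFreq h) (λ a → *-congˡ (sym (*-distribˡ-sumWhen Ninv (isFreq i) (F a))))) ⟩
    Ninv * sumWhen (isFreq h) (λ a → Ninv * (Ninv * sumWhen (isFreq i) (F a)))
      ≈⟨ *-congˡ (sym (*-distribˡ-sumWhen Ninv (isFreq h) (λ a → Ninv * sumWhen (isFreq i) (F a)))) ⟩
    Ninv * (Ninv * sumWhen (isFreq h) (λ a → Ninv * sumWhen (isFreq i) (F a)))
      ≈⟨ *-congˡ (*-congˡ (sym (*-distribˡ-sumWhen Ninv (isFreq h) (λ a → sumWhen (isFreq i) (F a))))) ⟩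
    Ninv * (Ninv * (Ninv * zeroSums₃ h i j))
      ∎
    where
    F : X → X → Carrier
    F a b = sumWhen (isFreq j) (λ c → charSum (toℕ a +ℕ toℕ b +ℕ toℕ c))

  ℱ³ : ℕ → ℕ → ℕ → X → X → X → V3 → Carrier
  ℱ³ a b c x y z v = ℱ c z (λ z′ → ℱ b y (λ y′ → ℱ a x (λ x′ → v x′ y′ z′)))

  RotationInvariant : V3 → Set ℓ
  RotationInvariant v = ∀ x y z → v (next x) (next y) (next z) ≈ v x y z

  Λ-rotationInvariant : ∀ {v} → InΛ v → RotationInvariant v
  Λ-rotationInvariant gen          x y z = refl
  Λ-rotationInvariant zero∈        x y z = refl
  Λ-rotationInvariant (add∈ p q)   x y z = +-cong (Λ-rotationInvariant p x y z) (Λ-rotationInvariant q x y z)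
  Λ-rotationInvariant (scal∈ a p)  x y z = *-congˡ (Λ-rotationInvariant p x y z)
  Λ-rotationInvariant (resp∈ u≈v p) x y z =
    trans (sym (u≈v _ _ _)) (trans (Λ-rotationInvariant p x y z) (u≈v x y z))
  Λ-rotationInvariant (A¹∈ {v} p)  x y z = +-cong
    (trans (reflexive (≡.cong (λ t → v t (next y) (next z)) (prev-next x))) (Λ-rotationInvariant p (prev x) y z))
    (Λ-rotationInvariant p (next x) y z)
  Λ-rotationInvariant (A²∈ {v} p)  x y z = +-cong
    (trans (reflexive (≡.cong (λ t → v (next x) t (next z)) (prev-next y))) (Λ-rotationInvariant p x (prev y) z))
    (Λ-rotationInvariant p x (next y) z)
  Λ-rotationInvariant (A³∈ {v} p)  x y z = +-cong
    (trans (reflexive (≡.cong (λ t → v (next x) (next y) t) (prev-next z))) (Λ-rotationInvariant p x y (prev z)))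
    (Λ-rotationInvariant p x y (next z))
  Λ-rotationInvariant (A*¹∈ p)     x y z = *-cong (reflexive (≡.cong θ (dist-next-next y z))) (Λ-rotationInvariant p x y z)
  Λ-rotationInvariant (A*²∈ p)     x y z = *-cong (reflexive (≡.cong θ (dist-next-next x z))) (Λ-rotationInvariant p x y z)
  Λ-rotationInvariant (A*³∈ p)     x y z = *-cong (reflexive (≡.cong θ (dist-next-next x y))) (Λ-rotationInvariant p x y z)

  θprod : ℕ → ℕ → Carrier
  θprod zero    d = 1#
  θprod (suc n) d = (θ d - θ (suc n)) * θprod n d

  θprod-step : ∀ n d w → θ d * w + (- θ (suc n)) * w ≈ (θ d - θ (suc n)) * w
  θprod-step n d w = sym (distribʳ w (θ d) (- θ (suc n)))

  θprod-dist-xy∈Λ : ∀ n {v} → InΛ v → InΛ (λ x y z → θprod n (dist x y) * v x y z)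
  θprod-dist-xy∈Λ zero    v∈Λ = resp∈ (λ _ _ _ → sym (*-identityˡ _)) v∈Λ
  θprod-dist-xy∈Λ (suc n) {v} v∈Λ = resp∈ (λ x y z → trans (θprod-step n (dist x y) _) (sym (*-assoc _ _ _)))
    (add∈ (A*³∈ w∈Λ) (scal∈ (- θ (suc n)) w∈Λ))
    where
    w∈Λ : InΛ (λ x y z → θprod n (dist x y) * v x y z)
    w∈Λ = θprod-dist-xy∈Λ n v∈Λ

  θprod-dist-xz∈Λ : ∀ n {v} → InΛ v → InΛ (λ x y z → θprod n (dist x z) * v x y z)
  θprod-dist-xz∈Λ zero    v∈Λ = resp∈ (λ _ _ _ → sym (*-identityˡ _)) v∈Λ
  θprod-dist-xz∈Λ (suc n) {v} v∈Λ = resp∈ (λ x y z → trans (θprod-step n (dist x z) _) (sym (*-assoc _ _ _)))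
    (add∈ (A*²∈ w∈Λ) (scal∈ (- θ (suc n)) w∈Λ))
    where
    w∈Λ : InΛ (λ x y z → θprod n (dist x z) * v x y z)
    w∈Λ = θprod-dist-xz∈Λ n v∈Λ

  θprod-vanishes : ∀ n d → 0 < d → d ≤ n → θprod n d ≈ 0#
  θprod-vanishes zero    (suc _) _ ()
  θprod-vanishes (suc n) d 0<d d≤1+n with ℕ.m≤n⇒m<n∨m≡n d≤1+n
  ... | inj₁ d<1+n   = trans (*-congˡ (θprod-vanishes n d 0<d (s≤s⁻¹ d<1+n))) (zeroʳ _)
  ... | inj₂ ≡.refl  = trans (*-congʳ (-‿inverseʳ (θ d))) (zeroˡ _)

  sumF-*-combination : ∀ {m n} (e : Fin n → Carrier) k (c : Fin m → Carrier) (F : Fin m → Fin n → Carrier) →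
    sumF (λ w → e w * (k * sumF (λ t → c t * F t w))) ≈ k * sumF (λ t → c t * sumF (λ w → e w * F t w))
  sumF-*-combination e k c F = begin
    sumF (λ w → e w * (k * sumF (λ t → c t * F t w)))     ≈⟨ sumF-cong (λ w → x∙yz≈y∙xz (e w) k _) ⟩
    sumF (λ w → k * (e w * sumF (λ t → c t * F t w)))     ≈⟨ *-distribˡ-sumF k (λ w → e w * sumF (λ t → c t * F t w)) ⟨
    k * sumF (λ w → e w * sumF (λ t → c t * F t w))       ≈⟨ *-congˡ (sumF-cong (λ w → *-distribˡ-sumF (e w) (λ t → c t * F t w))) ⟩
    k * sumF (λ w → sumF (λ t → e w * (c t * F t w)))     ≈⟨ *-congˡ (sumF-comm (λ w t → e w * (c t * F t w))) ⟩
    k * sumF (λ t → sumF (λ w → e w * (c t * F t w)))     ≈⟨ *-congˡ (sumF-cong (λ t → sumF-cong (λ w → x∙yz≈y∙xz (e w) (c t) (F t w)))) ⟩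
    k * sumF (λ t → sumF (λ w → c t * (e w * F t w)))     ≈⟨ *-congˡ (sumF-cong (λ t → *-distribˡ-sumF (c t) (λ w → e w * F t w))) ⟨
    k * sumF (λ t → c t * sumF (λ w → e w * F t w))       ∎

  module RootOfUnity (ζᴺ≈1 : pow ζ N ≈ 1#) where

    pow-ζ-N : ∀ m → pow (pow ζ m) N ≈ 1#
    pow-ζ-N m = begin
      pow (pow ζ m) N  ≈⟨ pow-* ζ m N ⟨
      pow ζ (m *ℕ N)   ≡⟨ ≡.cong (pow ζ) (ℕ.*-comm m N) ⟩
      pow ζ (N *ℕ m)   ≈⟨ pow-* ζ N m ⟩
      pow (pow ζ N) m  ≈⟨ pow-cong m ζᴺ≈1 ⟩
      pow 1# m         ≈⟨ pow-one m ⟩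
      1#               ∎

    χ-next : ∀ m x y → χ m x (next y) * pow ζ m ≈ χ m x y
    χ-next m x y = begin
      pow ζ (m *ℕ d′) * pow ζ m       ≈⟨ pow-+ ζ (m *ℕ d′) m ⟨
      pow ζ (m *ℕ d′ +ℕ m)            ≡⟨ ≡.cong (pow ζ) (≡.trans (ℕ.+-comm (m *ℕ d′) m) (≡.sym (ℕ.*-suc m d′))) ⟩
      pow ζ (m *ℕ suc d′)             ≈⟨ pow-* ζ m (suc d′) ⟩
      pow (pow ζ m) (suc d′)          ≈⟨ pow-% (pow ζ m) (suc d′) (pow-ζ-N m) ⟨
      pow (pow ζ m) (suc d′ % N)      ≡⟨ ≡.cong (pow (pow ζ m)) (suc-diff-next x y) ⟩
      pow (pow ζ m) (diff x y)        ≈⟨ pow-* ζ m (diff x y) ⟨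
      χ m x y                         ∎
      where
      d′ : ℕ
      d′ = diff x (next y)

    χ-trivial : ∀ m x y → pow ζ m ≈ 1# → χ m x y ≈ 1#
    χ-trivial m x y ζᵐ≈1 = trans (pow-* ζ m (diff x y)) (trans (pow-cong (diff x y) ζᵐ≈1) (pow-one (diff x y)))

    ℱ-next : ∀ m x f → ℱ m x f * pow ζ m ≈ ℱ m x (λ x′ → f (next x′))
    ℱ-next m x f = begin
      ℱ m x f * pow ζ m                                          ≈⟨ *-congʳ (sumF-next (λ x′ → χ m x x′ * f x′)) ⟨
      sumF (λ x′ → χ m x (next x′) * f (next x′)) * pow ζ m      ≈⟨ *-distribʳ-sumF (pow ζ m) (λ x′ → χ m x (next x′) * f (next x′)) ⟩
      sumF (λ x′ → χ m x (next x′) * f (next x′) * pow ζ m)      ≈⟨ sumF-cong (λ x′ → twist x′) ⟩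
      ℱ m x (λ x′ → f (next x′))                                 ∎
      where
      twist : ∀ x′ → χ m x (next x′) * f (next x′) * pow ζ m ≈ χ m x x′ * f (next x′)
      twist x′ = trans (*-assoc _ _ _) (trans (*-congˡ (*-comm _ _)) (trans (sym (*-assoc _ _ _)) (*-congʳ (χ-next m x x′))))

    ℱ³-twist : ∀ {v} → RotationInvariant v → ∀ a b c x y z →
               ℱ³ a b c x y z v * pow ζ (a +ℕ b +ℕ c) ≈ ℱ³ a b c x y z v
    ℱ³-twist {v} v-inv a b c x y z = begin
      ℱ c z G * pow ζ (a +ℕ b +ℕ c)                            ≈⟨ *-congˡ split ⟩
      ℱ c z G * (pow ζ c * (pow ζ b * pow ζ a))                 ≈⟨ *-assoc _ _ _ ⟨
      ℱ c z G * pow ζ c * (pow ζ b * pow ζ a)                   ≈⟨ *-congʳ (ℱ-next c z G) ⟩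
      ℱ c z (λ z′ → G (next z′)) * (pow ζ b * pow ζ a)          ≈⟨ ℱ-*ʳ c z (λ z′ → G (next z′)) _ ⟩
      ℱ c z (λ z′ → G (next z′) * (pow ζ b * pow ζ a))          ≈⟨ ℱ-cong c z (λ z′ → sym (*-assoc _ _ _)) ⟩
      ℱ c z (λ z′ → G (next z′) * pow ζ b * pow ζ a)            ≈⟨ ℱ-cong c z (λ z′ → trans (*-congʳ (ℱ-next b y (H (next z′))))
                                                                     (ℱ-*ʳ b y (λ y′ → H (next z′) (next y′)) (pow ζ a))) ⟩
      ℱ c z (λ z′ → ℱ b y (λ y′ → H (next z′) (next y′) * pow ζ a))  ≈⟨ ℱ-cong c z (λ z′ → ℱ-cong b y (λ y′ → trans
                                                                     (ℱ-next a x (λ x′ → v x′ (next y′) (next z′)))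
                                                                     (ℱ-cong a x (λ x′ → v-inv x′ y′ z′)))) ⟩
      ℱ c z G                                                   ∎
      where
      split : pow ζ (a +ℕ b +ℕ c) ≈ pow ζ c * (pow ζ b * pow ζ a)
      split = trans (pow-+ ζ (a +ℕ b) c) (trans (*-comm _ _) (*-congˡ (trans (pow-+ ζ a b) (*-comm _ _))))
      H : X → X → Carrier
      H z′ y′ = ℱ a x (λ x′ → v x′ y′ z′)
      G : X → Carrier
      G z′ = ℱ b y (H z′)

  count-pos : ∀ x y z i j → dist x z ≡ i → dist z y ≡ j → 0 < count x y i j
  count-pos x y z i j xz≡i zy≡j =
    filter-some (λ z → (dist x z ≟ℕ i) ×-dec (dist z y ≟ℕ j)) (lose (∈-allFin z) (xz≡i , zy≡j))

  count-witness : ∀ x y i j → 0 < count x y i j → ∃ λ z → dist x z ≡ i × dist z y ≡ j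
  count-witness x y i j count>0 with filter (λ z → (dist x z ≟ℕ i) ×-dec (dist z y ≟ℕ j)) (allFin N) in eq
  ... | z ∷ _ = z , proj₂ (∈-filter⁻ (λ z → (dist x z ≟ℕ i) ×-dec (dist z y ≟ℕ j)) {xs = allFin N}
                                     (≡.subst (z ∈_) (≡.sym eq) (here ≡.refl)))

  E*-pass : ∀ h i j v x y z → dist y z ≡ h → dist x z ≡ i → dist x y ≡ j → E*¹ h (E*² i (E*³ j v)) x y z ≈ v x y z
  E*-pass h i j v x y z yz≡h xz≡i xy≡j with dist y z ≟ℕ h | dist x z ≟ℕ i | dist x y ≟ℕ j
  ... | yes _  | yes _  | yes _  = refl
  ... | no yz≢h | _      | _      = ⊥-elim (yz≢h yz≡h)
  ... | yes _  | no xz≢i | _      = ⊥-elim (xz≢i xz≡i)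
  ... | yes _  | yes _  | no xy≢j = ⊥-elim (xy≢j xy≡j)

  module Diameter (D : ℕ) (2≤D : 2 ≤ D) (N≡2D⊎2D+1 : N ≡ 2 *ℕ D ⊎ N ≡ suc (2 *ℕ D)) where

    2*D≡D+D : 2 *ℕ D ≡ D +ℕ D
    2*D≡D+D = ≡.cong (D +ℕ_) (ℕ.+-identityʳ D)

    D+D≤N : D +ℕ D ≤ N
    D+D≤N = [ (λ N≡2D → ℕ.≤-reflexive (≡.sym (≡.trans N≡2D 2*D≡D+D)))
            , (λ N≡2D+1 → ℕ.≤-trans (ℕ.n≤1+n _) (ℕ.≤-reflexive (≡.sym (≡.trans N≡2D+1 (≡.cong suc 2*D≡D+D))))) ] N≡2D⊎2D+1

    N≤1+D+D : N ≤ suc (D +ℕ D)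
    N≤1+D+D = [ (λ N≡2D → ℕ.≤-trans (ℕ.≤-reflexive (≡.trans N≡2D 2*D≡D+D)) (ℕ.n≤1+n _))
              , (λ N≡2D+1 → ℕ.≤-reflexive (≡.trans N≡2D+1 (≡.cong suc 2*D≡D+D))) ] N≡2D⊎2D+1

    ≤D⇒<N : ∀ {h} → h ≤ D → h < N
    ≤D⇒<N h≤D = ℕ.<-≤-trans (ℕ.≤-<-trans h≤D (ℕ.m<m+n D (ℕ.<-≤-trans z<s 2≤D))) D+D≤N

    ≤D-+≡N⇒≡ : ∀ {h h′} → h ≤ D → h′ ≤ D → h +ℕ h′ ≡ N → h ≡ h′
    ≤D-+≡N⇒≡ {h} {h′} h≤D h′≤D h+h′≡N = ≡.trans (ℕ.≤-antisym h≤D D≤h) (≡.sym (ℕ.≤-antisym h′≤D D≤h′))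
      where
      D+D≤h+h′ : D +ℕ D ≤ h +ℕ h′
      D+D≤h+h′ = ℕ.≤-trans D+D≤N (ℕ.≤-reflexive (≡.sym h+h′≡N))
      D≤h : D ≤ h
      D≤h = ℕ.+-cancelʳ-≤ D D h (ℕ.≤-trans D+D≤h+h′ (ℕ.+-monoʳ-≤ h h′≤D))
      D≤h′ : D ≤ h′
      D≤h′ = ℕ.+-cancelˡ-≤ D D h′ (ℕ.≤-trans D+D≤h+h′ (ℕ.+-monoˡ-≤ h′ h≤D))

    dist≤D : ∀ x y → dist x y ≤ D
    dist≤D x y with diff x y ≤? D
    ... | yes d≤D = ℕ.≤-trans (ℕ.m⊓n≤m (diff x y) _) d≤D
    ... | no  d≰D = ℕ.≤-trans (ℕ.m⊓n≤n (diff x y) _)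
                      (ℕ.m≤n+o⇒m∸n≤o N (diff x y) (ℕ.≤-trans N≤1+D+D (ℕ.+-monoˡ-≤ D (ℕ.≰⇒> d≰D))))

    fromℕ≤D : ∀ {h} → h ≤ D → X
    fromℕ≤D h≤D = fromℕ< (≤D⇒<N h≤D)

    dist-fromℕ≤D : ∀ {h} (h≤D : h ≤ D) → dist (fromℕ≤D h≤D) x₀ ≡ h
    dist-fromℕ≤D {h} h≤D = ≡.trans (≡.cong (λ d → d ⊓ (N ∸ d)) diff≡h) (ℕ.m≤n⇒m⊓n≡m h≤N∸h)
      where
      diff≡h : diff (fromℕ≤D h≤D) x₀ ≡ h
      diff≡h = diff-unique (fromℕ≤D h≤D) x₀ h (≤D⇒<N h≤D)
        (≡.trans (≡.cong (λ k → (h +ℕ k) % N) toℕ-x₀) (≡.trans (≡.cong (_% N) (ℕ.+-identityʳ h))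
          (≡.trans (m<n⇒m%n≡m (≤D⇒<N h≤D)) (≡.sym (Fin.toℕ-fromℕ< (≤D⇒<N h≤D))))))
      h≤N∸h : h ≤ N ∸ h
      h≤N∸h = ℕ.m+n≤o⇒m≤o∸n h (ℕ.≤-trans (ℕ.+-mono-≤ h≤D h≤D) D+D≤N)

    isFreq-unique : ∀ {h h′} a → h ≤ D → h′ ≤ D → isFreq h a ≡ true → isFreq h′ a ≡ true → h ≡ h′
    isFreq-unique {h} {h′} a h≤D h′≤D a∈Mₕ a∈Mₕ′ = cases (isFreq-elim h a a∈Mₕ) (isFreq-elim h′ a a∈Mₕ′)
      where
      cases : toℕ a ≡ h ⊎ toℕ a +ℕ h ≡ N → toℕ a ≡ h′ ⊎ toℕ a +ℕ h′ ≡ N → h ≡ h′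
      cases (inj₁ a≡h)   (inj₁ a≡h′)   = ≡.trans (≡.sym a≡h) a≡h′
      cases (inj₁ a≡h)   (inj₂ a+h′≡N) = ≤D-+≡N⇒≡ h≤D h′≤D (≡.trans (≡.cong (_+ℕ h′) (≡.sym a≡h)) a+h′≡N)
      cases (inj₂ a+h≡N) (inj₁ a≡h′)   = ≤D-+≡N⇒≡ h≤D h′≤D
                                           (≡.trans (ℕ.+-comm h h′) (≡.trans (≡.cong (_+ℕ h) (≡.sym a≡h′)) a+h≡N))
      cases (inj₂ a+h≡N) (inj₂ a+h′≡N) = ℕ.+-cancelˡ-≡ (toℕ a) h h′ (≡.trans a+h≡N (≡.sym a+h′≡N))

    isFreq-fromℕ≤D : ∀ {h} (h≤D : h ≤ D) → isFreq h (fromℕ≤D h≤D) ≡ true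
    isFreq-fromℕ≤D h≤D = isFreq-intro _ (fromℕ≤D h≤D) (inj₁ (Fin.toℕ-fromℕ< (≤D⇒<N h≤D)))

    IsKrein : (ℕ → ℕ → ℕ → Carrier) → Set ℓ
    IsKrein q = ∀ i j → i ≤ D → j ≤ D → ∀ x y →
      Emat i x y * Emat j x y ≈ Ninv * sumF (λ (h : Fin (suc D)) → q (toℕ h) i j * Emat (toℕ h) x y)

    θprod-dist-off : ∀ x y → x ≢ y → θprod D (dist x y) ≈ 0#
    θprod-dist-off x y x≢y = θprod-vanishes D (dist x y) (ℕ.n≢0⇒n>0 (λ d≡0 → x≢y (dist≡0⇒≡ x y d≡0))) (dist≤D x y)

    c₀ : Carrier
    c₀ = θprod D 0

    sumF-*-θprod-dist : ∀ x (g : X → Carrier) → sumF (λ y → g y * θprod D (dist x y)) ≈ g x * c₀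
    sumF-*-θprod-dist x g = begin
      sumF (λ y → g y * θprod D (dist x y))
        ≈⟨ sumF-single (λ y → g y * θprod D (dist x y)) x
             (λ y y≢x → trans (*-congˡ (θprod-dist-off x y (λ x≡y → y≢x (≡.sym x≡y)))) (zeroʳ _)) ⟩
      g x * θprod D (dist x x)  ≡⟨ ≡.cong (λ d → g x * θprod D d) (dist-refl x) ⟩
      g x * c₀                  ∎

    Φ : V3
    Φ x y z = θprod D (dist x y) * (θprod D (dist x z) * 1#)

    Φ∈Λ : InΛ Φ
    Φ∈Λ = θprod-dist-xy∈Λ D (θprod-dist-xz∈Λ D gen)

    E³-Φ : ∀ j x y → E³ j Φ x y x₀ ≈ Emat j x₀ x * θprod D (dist x y) * c₀
    E³-Φ j x y = trans (sumF-cong {N} (λ z → solve 4 (λ e p q u → e :* (p :* (q :* u)) := e :* p :* q :* u) refl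
                                          (Emat j x₀ z) (θprod D (dist x y)) (θprod D (dist x z)) 1#))
      (trans (sumF-cong {N} (λ z → *-identityʳ _)) (sumF-*-θprod-dist x (λ z → Emat j x₀ z * θprod D (dist x y))))

    E¹E²E³-Φ : ∀ h i j → E¹ h (E² i (E³ j Φ)) x₀ x₀ x₀ ≈ (c₀ * c₀) * Etriple h i j
    E¹E²E³-Φ h i j = begin
      sumF (λ x → Emat h x₀ x * sumF (λ y → Emat i x₀ y * E³ j Φ x y x₀))
        ≈⟨ sumF-cong {N} (λ x → *-congˡ (trans (sumF-cong {N} (λ y → *-congˡ (E³-Φ j x y))) (E²-Φ x))) ⟩
      sumF (λ x → Emat h x₀ x * (Emat i x₀ x * (Emat j x₀ x * c₀) * c₀))
        ≈⟨ sumF-cong {N} (λ x → solve 5 (λ e f g a b → e :* (f :* (g :* a) :* b) := (a :* b) :* (e :* (f :* g))) refl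
                                          (Emat h x₀ x) (Emat i x₀ x) (Emat j x₀ x) c₀ c₀) ⟩
      sumF (λ x → (c₀ * c₀) * (Emat h x₀ x * (Emat i x₀ x * Emat j x₀ x)))
        ≈⟨ *-distribˡ-sumF (c₀ * c₀) (λ x → Emat h x₀ x * (Emat i x₀ x * Emat j x₀ x)) ⟨
      (c₀ * c₀) * Etriple h i j ∎
      where
      E²-Φ : ∀ x → sumF (λ y → Emat i x₀ y * (Emat j x₀ x * θprod D (dist x y) * c₀)) ≈ Emat i x₀ x * (Emat j x₀ x * c₀) * c₀
      E²-Φ x = trans (sumF-cong {N} (λ y → solve 4 (λ e f p a → e :* (f :* p :* a) := e :* (f :* a) :* p) refl
                                              (Emat i x₀ y) (Emat j x₀ x) (θprod D (dist x y)) c₀))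
                     (sumF-*-θprod-dist x (λ y → Emat i x₀ y * (Emat j x₀ x * c₀)))

    IsIntersectionNumbers : (ℕ → ℕ → ℕ → ℕ) → Set
    IsIntersectionNumbers p =
      ∀ h i j x y → h ≤ D → i ≤ D → j ≤ D → dist x y ≡ h → count x y i j ≡ p h i j

    E*-kills⇔p≡0 : ¬ (1# ≈ 0#) → ∀ p → IsIntersectionNumbers p → ∀ h i j → h ≤ D → i ≤ D → j ≤ D →
                   KillsΛ (λ v → E*¹ h (E*² i (E*³ j v))) ⇔ (p h i j ≡ 0)
    E*-kills⇔p≡0 1≉0 p p-count h i j h≤D i≤D j≤D = mk⇔ kills⇒p≡0 p≡0⇒kills
      where
      xₕ : X
      xₕ = fromℕ≤D h≤D
      kills⇒p≡0 : KillsΛ (λ v → E*¹ h (E*² i (E*³ j v))) → p h i j ≡ 0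
      kills⇒p≡0 kills with p h i j in p≡
      ... | zero  = ≡.refl
      ... | suc _ with count-witness xₕ x₀ i j
                         (≡.subst (0 <_) (≡.sym (≡.trans (p-count h i j xₕ x₀ h≤D i≤D j≤D (dist-fromℕ≤D h≤D)) p≡)) z<s)
      ... | z , xₕz≡i , zx₀≡j = ⊥-elim (1≉0 (trans (sym one³-survives) (kills one³ gen z x₀ xₕ)))
        where
        one³-survives : E*¹ h (E*² i (E*³ j one³)) z x₀ xₕ ≈ 1#
        one³-survives = E*-pass h i j one³ z x₀ xₕ (≡.trans (dist-sym xₕ x₀) (dist-fromℕ≤D h≤D))
                                                  (≡.trans (dist-sym xₕ z) xₕz≡i) zx₀≡j
      p≡0⇒kills : p h i j ≡ 0 → KillsΛ (λ v → E*¹ h (E*² i (E*³ j v)))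
      p≡0⇒kills p≡0 v _ x y z with dist y z ≟ℕ h | dist x z ≟ℕ i | dist x y ≟ℕ j
      ... | no _     | _        | _        = refl
      ... | yes _    | no _     | _        = refl
      ... | yes _    | yes _    | no _     = refl
      ... | yes yz≡h | yes xz≡i | yes xy≡j = ⊥-elim (ℕ.<⇒≢ (count-pos z y x i j (≡.trans (dist-sym x z) xz≡i) xy≡j)
          (≡.sym (≡.trans (p-count h i j z y h≤D i≤D j≤D (≡.trans (dist-sym y z) yz≡h)) p≡0)))

  module Field
    (inverse : ∀ x → ¬ (x ≈ 0#) → ∃ λ y → x * y ≈ 1#)
    (char0 : ∀ n → ¬ (fromℕ (suc n) ≈ 0#))
    (ζᴺ≈1 : pow ζ N ≈ 1#) (ζ-primitive : ∀ k → 0 < k → k < N → ¬ (pow ζ k ≈ 1#))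
    (N*Ninv≈1 : fromℕ N * Ninv ≈ 1#)
    (D : ℕ) (2≤D : 2 ≤ D) (N≡2D⊎2D+1 : N ≡ 2 *ℕ D ⊎ N ≡ suc (2 *ℕ D)) where

    open RootOfUnity ζᴺ≈1
    open Diameter D 2≤D N≡2D⊎2D+1

    1≉0 : ¬ (1# ≈ 0#)
    1≉0 1≈0 = char0 0 (trans (+-identityʳ 1#) 1≈0)

    *-cancelˡ : ∀ {k x y} → ¬ (k ≈ 0#) → k * x ≈ k * y → x ≈ y
    *-cancelˡ {k} {x} {y} k≉0 kx≈ky with inverse k k≉0
    ... | k⁻¹ , k*k⁻¹≈1 = begin
      x                ≈⟨ *-identityˡ x ⟨
      1# * x           ≈⟨ *-congʳ k*k⁻¹≈1 ⟨
      (k * k⁻¹) * x    ≈⟨ *-congʳ (*-comm k k⁻¹) ⟩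
      (k⁻¹ * k) * x    ≈⟨ *-assoc k⁻¹ k x ⟩
      k⁻¹ * (k * x)    ≈⟨ *-congˡ kx≈ky ⟩
      k⁻¹ * (k * y)    ≈⟨ *-assoc k⁻¹ k y ⟨
      (k⁻¹ * k) * y    ≈⟨ *-congʳ (*-comm k⁻¹ k) ⟩
      (k * k⁻¹) * y    ≈⟨ *-congʳ k*k⁻¹≈1 ⟩
      1# * y           ≈⟨ *-identityˡ y ⟩
      y                ∎

    x*y≈0⇒y≈0 : ∀ {x y} → ¬ (x ≈ 0#) → x * y ≈ 0# → y ≈ 0#
    x*y≈0⇒y≈0 {x} x≉0 xy≈0 = *-cancelˡ x≉0 (trans xy≈0 (sym (zeroʳ x)))

    x*y≉0 : ∀ {x y} → ¬ (x ≈ 0#) → ¬ (y ≈ 0#) → ¬ (x * y ≈ 0#)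
    x*y≉0 x≉0 y≉0 xy≈0 = y≉0 (x*y≈0⇒y≈0 x≉0 xy≈0)

    S*u≈S⇒S≈0 : ∀ {S u} → S * u ≈ S → ¬ (u ≈ 1#) → S ≈ 0#
    S*u≈S⇒S≈0 {S} {u} Su≈S u≉1 = x*y≈0⇒y≈0 (λ u-1≈0 → u≉1 (x∙y⁻¹≈ε⇒x≈y u 1# u-1≈0)) (begin
      (u - 1#) * S       ≈⟨ [y-z]x≈yx-zx S u 1# ⟩
      u * S - 1# * S     ≈⟨ +-cong (trans (*-comm u S) Su≈S) (-‿cong (*-identityˡ S)) ⟩
      S - S              ≈⟨ -‿inverseʳ S ⟩
      0#                 ∎)

    Ninv≉0 : ¬ (Ninv ≈ 0#)
    Ninv≉0 Ninv≈0 = 1≉0 (trans (sym N*Ninv≈1) (trans (*-congˡ Ninv≈0) (zeroʳ _)))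

    N≉0 : ¬ (fromℕ N ≈ 0#)
    N≉0 N≈0 = 1≉0 (trans (sym N*Ninv≈1) (trans (*-congʳ N≈0) (zeroˡ _)))

    fromℕ≈0⇒≡0 : ∀ n → fromℕ n ≈ 0# → n ≡ 0
    fromℕ≈0⇒≡0 zero    _     = ≡.refl
    fromℕ≈0⇒≡0 (suc n) n+1≈0 = ⊥-elim (char0 n n+1≈0)

    IsNat : Carrier → Set ℓ
    IsNat r = ∃ λ n → r ≈ fromℕ n

    IsNat-when : ∀ b {r} → IsNat r → IsNat (when b r)
    IsNat-when true  r∈ℕ = r∈ℕ
    IsNat-when false _   = 0 , refl

    IsNat-sumF : ∀ {n} (f : Fin n → Carrier) → (∀ i → IsNat (f i)) → IsNat (sumF f)
    IsNat-sumF {zero}  f _   = 0 , refl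
    IsNat-sumF {suc n} f f∈ℕ with f∈ℕ fzero | IsNat-sumF (λ i → f (fsuc i)) (λ i → f∈ℕ (fsuc i))
    ... | a , fz≈a | b , rest≈b = a +ℕ b , trans (+-cong fz≈a rest≈b) (sym (fromℕ-+ a b))

    IsNat-sumWhen : ∀ {n} (B : Fin n → Bool) f → (∀ i → IsNat (f i)) → IsNat (sumWhen B f)
    IsNat-sumWhen B f f∈ℕ = IsNat-sumF (λ i → when (B i) (f i)) (λ i → IsNat-when (B i) (f∈ℕ i))

    sumF-IsNat-zero : ∀ {n} (f : Fin n → Carrier) → (∀ i → IsNat (f i)) → sumF f ≈ 0# → ∀ i → f i ≈ 0#
    sumF-IsNat-zero {suc n} f f∈ℕ Σf≈0 i with f∈ℕ fzero | IsNat-sumF (λ i → f (fsuc i)) (λ i → f∈ℕ (fsuc i))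
    ... | a , fz≈a | b , rest≈b = term≈0 i
      where
      a+b≡0 : a +ℕ b ≡ 0
      a+b≡0 = fromℕ≈0⇒≡0 (a +ℕ b) (trans (fromℕ-+ a b) (trans (sym (+-cong fz≈a rest≈b)) Σf≈0))
      term≈0 : ∀ i → f i ≈ 0#
      term≈0 fzero    = trans fz≈a (reflexive (≡.cong fromℕ (ℕ.m+n≡0⇒m≡0 a a+b≡0)))
      term≈0 (fsuc i) = sumF-IsNat-zero (λ i → f (fsuc i)) (λ i → f∈ℕ (fsuc i))
        (trans rest≈b (reflexive (≡.cong fromℕ (ℕ.m+n≡0⇒n≡0 a a+b≡0)))) i

    sumWhen-IsNat-zero : ∀ {n} (B : Fin n → Bool) f → (∀ i → IsNat (f i)) → sumWhen B f ≈ 0# →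
                         ∀ i → B i ≡ true → f i ≈ 0#
    sumWhen-IsNat-zero B f f∈ℕ ΣBf≈0 i Bi≡true = begin
      f i              ≡⟨ ≡.cong (λ b → when b (f i)) Bi≡true ⟨
      when (B i) (f i) ≈⟨ sumF-IsNat-zero (λ i → when (B i) (f i)) (λ i → IsNat-when (B i) (f∈ℕ i)) ΣBf≈0 i ⟩
      0#               ∎

    n%N≡0⇔ζⁿ≈1 : ∀ n → n % N ≡ 0 ⇔ pow ζ n ≈ 1#
    n%N≡0⇔ζⁿ≈1 n = mk⇔ n%N≡0⇒ζⁿ≈1 ζⁿ≈1⇒n%N≡0
      where
      n%N≡0⇒ζⁿ≈1 : n % N ≡ 0 → pow ζ n ≈ 1#
      n%N≡0⇒ζⁿ≈1 n%N≡0 = trans (sym (pow-% ζ n ζᴺ≈1)) (reflexive (≡.cong (pow ζ) n%N≡0))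
      ζⁿ≈1⇒n%N≡0 : pow ζ n ≈ 1# → n % N ≡ 0
      ζⁿ≈1⇒n%N≡0 ζⁿ≈1 with n % N in n%N | pow-% ζ n ζᴺ≈1
      ... | zero  | _       = ≡.refl
      ... | suc k | ζᵏ⁺¹≈ζⁿ = ⊥-elim (ζ-primitive (suc k) z<s (≡.subst (_< N) n%N (m%n<n n N)) (trans ζᵏ⁺¹≈ζⁿ ζⁿ≈1))

    ζ^?≈1 : ∀ n → Dec (pow ζ n ≈ 1#)
    ζ^?≈1 n = Dec.map (n%N≡0⇔ζⁿ≈1 n) (n % N ≟ℕ 0)

    charSum-trivial : ∀ n → pow ζ n ≈ 1# → charSum n ≈ fromℕ N
    charSum-trivial n ζⁿ≈1 = trans (sumF-cong {N} (λ w → trans (*-identityʳ _) (χ-trivial n x₀ w ζⁿ≈1))) (sumF-one N)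

    charSum-nontrivial : ∀ n → ¬ (pow ζ n ≈ 1#) → charSum n ≈ 0#
    charSum-nontrivial n ζⁿ≉1 = S*u≈S⇒S≈0 (ℱ-next n x₀ (λ _ → 1#)) ζⁿ≉1

    IsNat-charSum : ∀ n → IsNat (charSum n)
    IsNat-charSum n with ζ^?≈1 n
    ... | yes ζⁿ≈1 = N , charSum-trivial n ζⁿ≈1
    ... | no  ζⁿ≉1 = 0 , charSum-nontrivial n ζⁿ≉1

    charSum≈0⇒ζⁿ≉1 : ∀ n → charSum n ≈ 0# → ¬ (pow ζ n ≈ 1#)
    charSum≈0⇒ζⁿ≉1 n charSum≈0 ζⁿ≈1 = N≉0 (trans (sym (charSum-trivial n ζⁿ≈1)) charSum≈0)

    Ninv*x≈0⇒x≈0 : ∀ {x} → Ninv * x ≈ 0# → x ≈ 0#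
    Ninv*x≈0⇒x≈0 = x*y≈0⇒y≈0 Ninv≉0

    Epair-off : ∀ {h h′} → h ≤ D → h′ ≤ D → h′ ≢ h → Epair h h′ ≈ 0#
    Epair-off {h} {h′} h≤D h′≤D h′≢h = trans (Epair-expand h h′)
      (trans (*-congˡ (*-congˡ zeroSums₂≈0)) (trans (*-congˡ (zeroʳ Ninv)) (zeroʳ Ninv)))
      where
      zeroSums₂≈0 : zeroSums₂ h h′ ≈ 0#
      zeroSums₂≈0 = sumWhen-zero (isFreq h) (λ a a∈Mₕ → sumWhen-zero (isFreq h′) (λ b b∈Mₕ′ →
        charSum-nontrivial (toℕ a +ℕ toℕ b) (λ ζᵃ⁺ᵇ≈1 → h′≢h (isFreq-unique b h′≤D h≤D b∈Mₕ′
          (isFreq-neg-closed h a b a∈Mₕ (Equivalence.from (n%N≡0⇔ζⁿ≈1 (toℕ a +ℕ toℕ b)) ζᵃ⁺ᵇ≈1))))))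

    Epair-diag≉0 : ∀ {h} → h ≤ D → ¬ (Epair h h ≈ 0#)
    Epair-diag≉0 {h} h≤D Epair≈0 = N≉0 (trans (sym (charSum-trivial (toℕ a +ℕ toℕ (neg a)) ζᵃ⁺⁻ᵃ≈1)) charSum≈0)
      where
      a : X
      a = fromℕ≤D h≤D
      ζᵃ⁺⁻ᵃ≈1 : pow ζ (toℕ a +ℕ toℕ (neg a)) ≈ 1#
      ζᵃ⁺⁻ᵃ≈1 = Equivalence.to (n%N≡0⇔ζⁿ≈1 _) ([x+neg-x]%N≡0 a)
      zeroSums₂≈0 : zeroSums₂ h h ≈ 0#
      zeroSums₂≈0 = Ninv*x≈0⇒x≈0 (Ninv*x≈0⇒x≈0 (trans (sym (Epair-expand h h)) Epair≈0))
      inner : ∀ a → IsNat (sumWhen (isFreq h) (λ b → charSum (toℕ a +ℕ toℕ b)))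
      inner a = IsNat-sumWhen (isFreq h) _ (λ b → IsNat-charSum (toℕ a +ℕ toℕ b))
      charSum≈0 : charSum (toℕ a +ℕ toℕ (neg a)) ≈ 0#
      charSum≈0 = sumWhen-IsNat-zero (isFreq h) _ (λ b → IsNat-charSum (toℕ a +ℕ toℕ b))
        (sumWhen-IsNat-zero (isFreq h) _ inner zeroSums₂≈0 a (isFreq-fromℕ≤D h≤D))
        (neg a) (isFreq-neg-closed h a (neg a) (isFreq-fromℕ≤D h≤D) ([x+neg-x]%N≡0 a))

    θ₀-θₖ≉0 : ∀ k → 0 < k → k < N → ¬ (θ 0 - θ k ≈ 0#)
    θ₀-θₖ≉0 k 0<k k<N θ₀-θₖ≈0 =
      x*y≉0 (1-ζᵐ≉0 k 0<k k<N) (1-ζᵐ≉0 (N ∸ k) (ℕ.m<n⇒0<n∸m k<N) (ℕ.∸-monoʳ-< 0<k (ℕ.<⇒≤ k<N)))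
            (trans factorise θ₀-θₖ≈0)
      where
      a b : Carrier
      a = pow ζ k
      b = pow ζ (N ∸ k)
      1-ζᵐ≉0 : ∀ m → 0 < m → m < N → ¬ (1# - pow ζ m ≈ 0#)
      1-ζᵐ≉0 m 0<m m<N 1-ζᵐ≈0 = ζ-primitive m 0<m m<N (sym (x∙y⁻¹≈ε⇒x≈y 1# (pow ζ m) 1-ζᵐ≈0))
      -a*-b≈a*b : - a * - b ≈ a * b
      -a*-b≈a*b = trans (sym (-‿distribˡ-* a (- b))) (trans (-‿cong (sym (-‿distribʳ-* a b))) (-‿involutive (a * b)))
      a*b≈ζᴺ : a * b ≈ pow ζ N
      a*b≈ζᴺ = trans (sym (pow-+ ζ k (N ∸ k))) (reflexive (≡.cong (pow ζ) (ℕ.m+[n∸m]≡n (ℕ.<⇒≤ k<N))))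
      factorise : (1# - a) * (1# - b) ≈ θ 0 - θ k
      factorise = begin
        (1# + - a) * (1# + - b)
          ≈⟨ solve 3 (λ o p q → (o :+ p) :* (o :+ q) := (o :* o :+ p :* q) :+ (o :* p :+ o :* q)) refl 1# (- a) (- b) ⟩
        (1# * 1# + - a * - b) + (1# * - a + 1# * - b)
          ≈⟨ +-cong (+-cong (*-identityˡ 1#) (trans -a*-b≈a*b a*b≈ζᴺ))
            (trans (+-cong (*-identityˡ (- a)) (*-identityˡ (- b))) (-‿+-comm a b)) ⟩
        (1# + pow ζ N) + - (a + b)       ∎

    θprod-0≉0 : ∀ n → n ≤ D → ¬ (θprod n 0 ≈ 0#)
    θprod-0≉0 zero    _     = 1≉0
    θprod-0≉0 (suc n) 1+n≤D = x*y≉0 (θ₀-θₖ≉0 (suc n) z<s (≤D⇒<N 1+n≤D)) (θprod-0≉0 n (ℕ.<⇒≤ 1+n≤D))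

    Etriple-krein : ∀ q → IsKrein q → ∀ {h i j} → h ≤ D → i ≤ D → j ≤ D → Etriple h i j ≈ Ninv * (q h i j * Epair h h)
    Etriple-krein q krein {h} {i} {j} h≤D i≤D j≤D = begin
      sumF (λ w → Emat h x₀ w * (Emat i x₀ w * Emat j x₀ w))
        ≈⟨ sumF-cong {N} (λ w → *-congˡ (krein i j i≤D j≤D x₀ w)) ⟩
      sumF (λ w → Emat h x₀ w * (Ninv * sumF (λ (t : Fin (suc D)) → q (toℕ t) i j * Emat (toℕ t) x₀ w)))
        ≈⟨ sumF-*-combination (Emat h x₀) Ninv (λ (t : Fin (suc D)) → q (toℕ t) i j) (λ t → Emat (toℕ t) x₀) ⟩
      Ninv * sumF (λ (t : Fin (suc D)) → q (toℕ t) i j * Epair h (toℕ t))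
        ≈⟨ *-congˡ (sumF-single (λ t → q (toℕ t) i j * Epair h (toℕ t)) ĥ off-diagonal) ⟩
      Ninv * (q (toℕ ĥ) i j * Epair h (toℕ ĥ))
        ≡⟨ ≡.cong (λ k → Ninv * (q k i j * Epair h k)) toℕ-ĥ ⟩
      Ninv * (q h i j * Epair h h) ∎
      where
      ĥ : Fin (suc D)
      ĥ = fromℕ< (s≤s h≤D)
      toℕ-ĥ : toℕ ĥ ≡ h
      toℕ-ĥ = Fin.toℕ-fromℕ< (s≤s h≤D)
      off-diagonal : ∀ t → t ≢ ĥ → q (toℕ t) i j * Epair h (toℕ t) ≈ 0#
      off-diagonal t t≢ĥ = trans (*-congˡ (Epair-off h≤D (s≤s⁻¹ (Fin.toℕ<n t))
        (λ t≡h → t≢ĥ (Fin.toℕ-injective (≡.trans t≡h (≡.sym toℕ-ĥ)))))) (zeroʳ _)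

    ZeroSumFree : ℕ → ℕ → ℕ → Set ℓ
    ZeroSumFree h i j = ∀ a b c → isFreq h a ≡ true → isFreq i b ≡ true → isFreq j c ≡ true →
                        ¬ (pow ζ (toℕ a +ℕ toℕ b +ℕ toℕ c) ≈ 1#)

    ZeroSumFree⇒kills : ∀ {h i j} → ZeroSumFree h i j → ∀ {v} → RotationInvariant v →
                        ∀ x y z → E¹ h (E² i (E³ j v)) x y z ≈ 0#
    ZeroSumFree⇒kills {h} {i} {j} free {v} v-inv x y z =
      Emat-annihilates h x (λ x′ → E² i (E³ j v) x′ y z) (λ a a∈Mₕ → begin
        ℱ (toℕ a) x (λ x′ → sumF (λ y′ → Emat i y y′ * E³ j v x′ y′ z))
          ≈⟨ ℱ-sumF (toℕ a) x (Emat i y) (λ x′ y′ → E³ j v x′ y′ z) ⟩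
        sumF (λ y′ → Emat i y y′ * ℱ (toℕ a) x (λ x′ → E³ j v x′ y′ z))
          ≈⟨ Emat-annihilates i y (λ y′ → ℱ (toℕ a) x (λ x′ → E³ j v x′ y′ z)) (λ b b∈Mᵢ → begin
               ℱ (toℕ b) y (λ y′ → ℱ (toℕ a) x (λ x′ → sumF (λ z′ → Emat j z z′ * v x′ y′ z′)))
                 ≈⟨ ℱ-cong (toℕ b) y (λ y′ → ℱ-sumF (toℕ a) x (Emat j z) (λ x′ z′ → v x′ y′ z′)) ⟩
               ℱ (toℕ b) y (λ y′ → sumF (λ z′ → Emat j z z′ * ℱ (toℕ a) x (λ x′ → v x′ y′ z′)))
                 ≈⟨ ℱ-sumF (toℕ b) y (Emat j z) (λ y′ z′ → ℱ (toℕ a) x (λ x′ → v x′ y′ z′)) ⟩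
               sumF (λ z′ → Emat j z z′ * ℱ (toℕ b) y (λ y′ → ℱ (toℕ a) x (λ x′ → v x′ y′ z′)))
                 ≈⟨ Emat-annihilates j z _ (λ c c∈Mⱼ → S*u≈S⇒S≈0 (ℱ³-twist v-inv (toℕ a) (toℕ b) (toℕ c) x y z)
                                                               (free a b c a∈Mₕ b∈Mᵢ c∈Mⱼ)) ⟩
               0# ∎) ⟩
        0# ∎)

    q≈0⇒ZeroSumFree : ∀ q → IsKrein q → ∀ {h i j} → h ≤ D → i ≤ D → j ≤ D → q h i j ≈ 0# → ZeroSumFree h i j
    q≈0⇒ZeroSumFree q krein {h} {i} {j} h≤D i≤D j≤D q≈0 a b c a∈Mₕ b∈Mᵢ c∈Mⱼ =
      charSum≈0⇒ζⁿ≉1 (toℕ a +ℕ toℕ b +ℕ toℕ c)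
        (sumWhen-IsNat-zero (isFreq j) (F₀ a b) (IsNat-F₀ a b)
          (sumWhen-IsNat-zero (isFreq i) (F₁ a) (IsNat-F₁ a)
            (sumWhen-IsNat-zero (isFreq h) F₂ IsNat-F₂ zeroSums₃≈0 a a∈Mₕ) b b∈Mᵢ) c c∈Mⱼ)
      where
      F₀ : X → X → X → Carrier
      F₀ a b c = charSum (toℕ a +ℕ toℕ b +ℕ toℕ c)
      F₁ : X → X → Carrier
      F₁ a b = sumWhen (isFreq j) (F₀ a b)
      F₂ : X → Carrier
      F₂ a = sumWhen (isFreq i) (F₁ a)
      IsNat-F₀ : ∀ a b c → IsNat (F₀ a b c)
      IsNat-F₀ a b c = IsNat-charSum (toℕ a +ℕ toℕ b +ℕ toℕ c)
      IsNat-F₁ : ∀ a b → IsNat (F₁ a b)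
      IsNat-F₁ a b = IsNat-sumWhen (isFreq j) (F₀ a b) (IsNat-F₀ a b)
      IsNat-F₂ : ∀ a → IsNat (F₂ a)
      IsNat-F₂ a = IsNat-sumWhen (isFreq i) (F₁ a) (IsNat-F₁ a)
      zeroSums₃≈0 : zeroSums₃ h i j ≈ 0#
      zeroSums₃≈0 = Ninv*x≈0⇒x≈0 (Ninv*x≈0⇒x≈0 (Ninv*x≈0⇒x≈0 (begin
        Ninv * (Ninv * (Ninv * zeroSums₃ h i j)) ≈⟨ Etriple-expand h i j ⟨
        Etriple h i j                            ≈⟨ Etriple-krein q krein h≤D i≤D j≤D ⟩
        Ninv * (q h i j * Epair h h)             ≈⟨ *-congˡ (trans (*-congʳ q≈0) (zeroˡ _)) ⟩
        Ninv * 0#                                ≈⟨ zeroʳ Ninv ⟩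
        0#                                       ∎)))

    E-kills⇔q≈0 : ∀ q → IsKrein q → ∀ h i j → h ≤ D → i ≤ D → j ≤ D →
                  KillsΛ (λ v → E¹ h (E² i (E³ j v))) ⇔ (q h i j ≈ 0#)
    E-kills⇔q≈0 q krein h i j h≤D i≤D j≤D = mk⇔ kills⇒q≈0 q≈0⇒kills
      where
      q≈0⇒kills : q h i j ≈ 0# → KillsΛ (λ v → E¹ h (E² i (E³ j v)))
      q≈0⇒kills q≈0 v v∈Λ = ZeroSumFree⇒kills (q≈0⇒ZeroSumFree q krein h≤D i≤D j≤D q≈0) (Λ-rotationInvariant v∈Λ)
      kills⇒q≈0 : KillsΛ (λ v → E¹ h (E² i (E³ j v))) → q h i j ≈ 0#
      kills⇒q≈0 kills = x*y≈0⇒y≈0 (Epair-diag≉0 h≤D) (trans (*-comm _ _) (Ninv*x≈0⇒x≈0 (begin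
        Ninv * (q h i j * Epair h h)  ≈⟨ Etriple-krein q krein h≤D i≤D j≤D ⟨
        Etriple h i j                 ≈⟨ x*y≈0⇒y≈0 c₀²≉0 (trans (sym (E¹E²E³-Φ h i j)) (kills Φ Φ∈Λ x₀ x₀ x₀)) ⟩
        0#                            ∎)))
        where
        c₀²≉0 : ¬ (c₀ * c₀ ≈ 0#)
        c₀²≉0 = x*y≉0 (θprod-0≉0 D ℕ.≤-refl) (θprod-0≉0 D ℕ.≤-refl)

lemma10p1 : ∀ {c ℓ} (R : CommutativeRing c ℓ) (D N : ℕ) {{_ : NonZero N}}
    (ζ Ninv : CommutativeRing.Carrier R) →
    let open CommutativeRing R
        open Cycle R N ζ Ninv
    in
    -- R is a field of characteristic zero
    (∀ x → ¬ (x ≈ 0#) → ∃ λ y → x * y ≈ 1#) →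
    (∀ n → ¬ (fromℕ (suc n) ≈ 0#)) →
    -- D ≥ 2 and N ∈ {2D, 2D+1}
    2 ≤ D → (N ≡ 2 *ℕ D ⊎ N ≡ suc (2 *ℕ D)) →
    -- ζ is a primitive N-th root of unity, Ninv = N⁻¹
    pow ζ N ≈ 1# → (∀ k → 0 < k → k < N → ¬ (pow ζ k ≈ 1#)) →
    fromℕ N * Ninv ≈ 1# →
    -- p h i j are the intersection numbers p^h_{ij}
    (p : ℕ → ℕ → ℕ → ℕ) →
    (∀ h i j x y → h ≤ D → i ≤ D → j ≤ D → dist x y ≡ h → count x y i j ≡ p h i j) →
    -- q h i j are the Krein parameters: E_i ∘ E_j = N⁻¹ Σ_h q^h_{ij} E_h
    (q : ℕ → ℕ → ℕ → Carrier) →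
    (∀ i j → i ≤ D → j ≤ D → ∀ x y →
       Emat i x y * Emat j x y
         ≈ Ninv * sumF (λ (h : Fin (suc D)) → q (toℕ h) i j * Emat (toℕ h) x y)) →
    ∀ h i j → h ≤ D → i ≤ D → j ≤ D →
      (KillsΛ (λ v → E*¹ h (E*² i (E*³ j v))) ⇔ (p h i j ≡ 0))
      × (KillsΛ (λ v → E¹ h (E² i (E³ j v))) ⇔ (q h i j ≈ 0#))
lemma10p1 R D N ζ Ninv inverse char0 2≤D N≡2D⊎2D+1 ζᴺ≈1 ζ-primitive N*Ninv≈1 p p-count q krein h i j h≤D i≤D j≤D =
  E*-kills⇔p≡0 1≉0 p p-count h i j h≤D i≤D j≤D , E-kills⇔q≈0 q krein h i j h≤D i≤D j≤D
  where
  open Properties R N ζ Ninv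
  open Diameter D 2≤D N≡2D⊎2D+1
  open Field inverse char0 ζᴺ≈1 ζ-primitive N*Ninv≈1 D 2≤D N≡2D⊎2D+1
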